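{- Let $H$ be a graph and let $R\subseteq V(H)$ be a dominating set of $H$. Let $f:V(H)\to\mathbb N$ satisfy $f(v)\ge\deg_H(v)$ for $v\in V(H)\setminus R$ and $f(r)\ge\deg_H(r)+1$ for $r\in R$. Suppose that $H$ has no induced Gallai tree subgraph $T$ such that $f$ is bad on $T$. Then for each pair $u,v\in V(H)$, either $H$ is $(f-1_{\{u,v\}})$-choosable, or $uv$ is an edge of $H$ with exactly one endpoint in $R$.
   Context: All graphs are finite and simple. For $g:V(H)\to\mathbb Z$, a $g$-assignment on $H$ assigns each $v$ a set $L(v)\subseteq\mathbb N$ with $|L(v)|=\max\{0,g(v)\}$, and $H$ is $g$-choosable if $H$ has a proper coloring $\phi$ with $\phi(v)\in L(v)$ for all $v$, for every $g$-assignment $L$. For $U\subseteq V(H)$, $1_U$ is the indicator function of $U$, so $(f-1_U)(v)=f(v)-1$ if $v\in U$ and $f(v)$ otherwise. A Gallai tree is a connected graph every block of which is a clique or an odd cycle. For a Gallai tree $T$ (an induced subgraph of $H$), $f$ is bad on $T$ if there exists $U\subseteq V(T)$ with $|U|\le 2$ such that $(f-1_U)(w)=\deg_T(w)$ for every $w\in V(T)$. -}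

module Defs where

open import Data.Nat using (ℕ; zero; suc; _+_; _*_; _≤_; _%_)
open import Data.Integer as ℤ using (ℤ; +_; -[1+_])
open import Data.Fin using (Fin; toℕ)
open import Data.Fin.Subset using (Subset; _∈_; _∉_; _⊆_; _∩_; _∪_; _-_; ∣_∣; ⁅_⁆; Nonempty)
open import Data.Vec using (lookup; tabulate)
open import Data.Bool using (Bool; true; false)
open import Data.List using (List; length)
open import Data.List.Membership.Propositional using () renaming (_∈_ to _∈ₗ_)
open import Data.List.Relation.Unary.Unique.Propositional using (Unique)
open import Data.Product using (Σ; ∃; ∃-syntax; _×_)
open import Data.Sum using (_⊎_)
open import Function.Definitions using (Injective)
open import Function.Bundles using (_⇔_)
open import Relation.Binary.PropositionalEquality using (_≡_; _≢_)

record Graph (n : ℕ) : Set where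
  field
    adj   : Fin n → Fin n → Bool
    sym   : ∀ u v → adj u v ≡ adj v u
    irrfl : ∀ v → adj v v ≡ false
open Graph public

module _ {n : ℕ} (G : Graph n) where

  nbhd : Fin n → Subset n
  nbhd v = tabulate (adj G v)

  deg : Fin n → ℕ
  deg v = ∣ nbhd v ∣

  degIn : Subset n → Fin n → ℕ
  degIn S w = ∣ S ∩ nbhd w ∣

  Dominating : Subset n → Set
  Dominating R = ∀ v → v ∉ R → ∃[ r ] (r ∈ R × adj G v r ≡ true)

  -- walks whose vertices (after the first) lie in S
  data Reach (S : Subset n) : Fin n → Fin n → Set where
    here : ∀ {a} → Reach S a a
    step : ∀ {a b c} → adj G a b ≡ true → b ∈ S → Reach S b c → Reach S a c

  -- H[S] is connected (vacuously true for S empty)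
  Connected : Subset n → Set
  Connected S = ∀ a b → a ∈ S → b ∈ S → Reach S a b

  NoCutVertex : Subset n → Set
  NoCutVertex B = ∀ x → x ∈ B → Connected (B - x)

  IsBlock : Subset n → Subset n → Set
  IsBlock S B =
    B ⊆ S × Nonempty B × Connected B × NoCutVertex B ×
    (∀ B' → B ⊆ B' → B' ⊆ S → Connected B' → NoCutVertex B' → B' ⊆ B)

  IsClique : Subset n → Set
  IsClique B = ∀ x y → x ∈ B → y ∈ B → x ≢ y → adj G x y ≡ true

  IsOddCycle : Subset n → Set
  IsOddCycle B = Σ ℕ λ m → Σ (Fin (3 + 2 * m) → Fin n) λ c →
    Injective _≡_ _≡_ c × (∀ i → c i ∈ B) × (∀ x → x ∈ B → ∃[ i ] c i ≡ x) ×
    (∀ i j → (adj G (c i) (c j) ≡ true) ⇔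
               ((suc (toℕ i) % (3 + 2 * m) ≡ toℕ j) ⊎ (suc (toℕ j) % (3 + 2 * m) ≡ toℕ i)))

  GallaiTree : Subset n → Set
  GallaiTree S = Nonempty S × Connected S ×
    (∀ B → IsBlock S B → IsClique B ⊎ IsOddCycle B)

  ind : Subset n → Fin n → ℤ
  ind U v with lookup U v
  ... | true  = + 1
  ... | false = + 0

  Bad : (Fin n → ℕ) → Subset n → Set
  Bad f S = ∃[ U ] (U ⊆ S × ∣ U ∣ ≤ 2 ×
    (∀ w → w ∈ S → (+ f w) ℤ.- ind U w ≡ + degIn S w))

  pos : ℤ → ℕ
  pos (+ k)    = k
  pos -[1+ _ ] = 0

  Choosable : (Fin n → ℤ) → Set
  Choosable g = ∀ (L : Fin n → List ℕ) → (∀ v → Unique (L v)) →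
    (∀ v → length (L v) ≡ pos (g v)) →
    Σ (Fin n → ℕ) λ φ → ((∀ v → φ v ∈ₗ L v) × (∀ u v → adj G u v ≡ true → φ u ≢ φ v))

{-# OPTIONS --safe #-}
-- Put D = R ─ {u, v} and X = V ─ D, and give w the list L w of size f w - 1_{u,v}(w).
-- On X every list is at least as long as the degree in H[X]: a vertex of {u, v}
-- outside R loses a neighbour in R, which lies in D unless uv is the exceptional edge.
-- By the theorem of Borodin and Erdős–Rubin–Taylor, H[X] is then L-colourable unless
-- an induced Gallai tree S ⊆ X has |L w| = deg_S w on all of S, and then f is bad on S
-- with U = S ∩ {u, v}. Finally each r ∈ D has more colours left than neighbours in D,
-- so the colouring of X extends greedily to D.
--
-- The Borodin–Erdős–Rubin–Taylor theorem is proved for a minimal uncolourable set S.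
-- It is connected with tight lists, and once S ─ B is coloured, a block B of H[S] is an
-- uncolourable 2-connected graph with tight residual lists. Adjacent vertices of B then
-- have equal lists, so B is regular. A 2-regular B is a cycle, and an even cycle is
-- 2-colourable. Otherwise, if B is not a clique, Brooks' lemma yields an induced path
-- y - x - z with B - y - z connected: give y and z the same colour and colour
-- B - y - z greedily towards x.
module Submission where

open import Defs hiding (sym)
open import Data.Nat using (ℕ; zero; suc; _+_; _*_; _≤_; _<_; z≤n; s≤s; _<?_; parity)
open import Data.Nat.DivMod using (_%_; m<n⇒m%n≡m; n%n≡0)
open import Data.Parity using (Parity; 0ℙ; 1ℙ)
open import Data.Parity.Properties using (p≢p⁻¹; suc-homo-⁻¹)
open import Data.Nat.Properties
  using (≤-refl; ≤-trans; ≤-antisym; ≤-reflexive; <-≤-trans; ≤-<-trans; <-trans; <⇒≤; <⇒≱; ≮⇒≥; ≤-pred;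
         +-suc; *-suc; +-comm; anyUpTo?; +-identityʳ; +-mono-≤; +-monoʳ-≤; +-cancelʳ-≤; n<1+n; <-irrefl;
         <-cmp; ≤∧≢⇒<; module ≤-Reasoning)
  renaming (_≟_ to _≟ℕ_)
open import Data.Bool using (Bool; true; false)
open import Data.Bool.Properties using () renaming (_≟_ to _≟ᵇ_)
open import Data.Fin using (Fin; zero; suc; toℕ; fromℕ<)
open import Data.Fin.Properties using (any?; all?; toℕ-fromℕ<; toℕ-injective; toℕ<n; pigeonhole) renaming (_≟_ to _≟ᶠ_)
open import Data.Fin.Subset using (Subset; _∈_; _∉_; _⊆_; _∩_; _∪_; _─_; _-_; ∣_∣; ⁅_⁆; Nonempty; Empty; ⊤)
open import Data.Fin.Subset.Properties
  using (_∈?_; _⊆?_; nonempty?; anySubset?; ∣p∣≤n; ∈⊤; x∈⁅x⁆; x∈⁅y⁆⇒x≡y; ∣⁅x⁆∣≡1; ⊆-antisym;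
         p⊆q⇒∣p∣≤∣q∣; p⊂q⇒∣p∣<∣q∣; p─x─y≡p─y─x; p─q─r≡p─q∪r; p∩q⊆p; p∩q⊆q; x∈p∩q⁺; x∈p∩q⁻;
         ∣p∩q∣≤∣q∣; x∈p∪q⁺; x∈p∪q⁻; ∪-comm; ∩-identityˡ; p─q⊆p; x∈p∧x∉q⇒x∈p─q; x∈p∧x≢y⇒x∈p-y;
         x∈p⇒∣p-x∣<∣p∣)
open import Data.Vec using (Vec; []; _∷_; lookup; tabulate; here; there)
open import Data.Vec.Properties using ([]=⇒lookup; lookup⇒[]=; lookup∘tabulate)
open import Data.List using (List; []; _∷_; length; filter; map; cartesianProductWith)
open import Data.List.Properties using (length-map; length-removeAt′)
open import Data.List.Membership.Propositional using () renaming (_∈_ to _∈ₗ_; _∉_ to _∉ₗ_)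
open import Data.List.Membership.Propositional.Properties using (∈-filter⁻; ∈-map⁺; ∈-map⁻; ∈-cartesianProductWith⁺)
open import Data.List.Membership.DecPropositional _≟ℕ_ using () renaming (_∈?_ to _∈ₗ?_)
open import Data.List.Relation.Unary.Any using (here; there; index) renaming (_─_ to _─ₗ_)
import Data.List.Relation.Unary.Any as Any
import Data.List.Relation.Unary.All as All
open import Data.List.Relation.Unary.Unique.Propositional using (Unique; _∷_)
import Data.List.Relation.Unary.Unique.Propositional.Properties as Unique
open import Data.Product using (∃; ∃-syntax; _×_; _,_; proj₁; proj₂)
open import Data.Sum using (_⊎_; inj₁; inj₂; [_,_])
open import Data.Empty using (⊥; ⊥-elim)
open import Function using (_∘_; const)
open import Function.Bundles using (mk⇔)
open import Relation.Binary.Definitions using (tri<; tri≈; tri>)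
open import Relation.Nullary using (¬_; Dec; yes; no; does; contradiction)
open import Relation.Nullary.Decidable using (_×-dec_; _⊎-dec_; _→-dec_; ¬?; dec-true; map′)
open import Relation.Unary using (Decidable)
open import Relation.Binary.PropositionalEquality
  using (_≡_; _≢_; refl; sym; trans; cong; cong₂; subst; subst₂; ≢-sym; module ≡-Reasoning)
open import Data.Integer as ℤ using (+_)

private variable
  m : ℕ

-- Lists

∈-─⁺ : {A : Set} {x z : A} {xs : List A} (x∈xs : x ∈ₗ xs) → z ∈ₗ xs → z ≢ x → z ∈ₗ (xs ─ₗ x∈xs)
∈-─⁺ (here refl)  (here refl)  z≢x = contradiction refl z≢x
∈-─⁺ (here refl)  (there z∈xs) _   = z∈xs
∈-─⁺ (there _)    (here refl)  _   = here refl
∈-─⁺ (there x∈xs) (there z∈xs) z≢x = there (∈-─⁺ x∈xs z∈xs z≢x)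

unique-⊆⇒length≤ : {A : Set} {xs ys : List A} → Unique xs → (∀ {z} → z ∈ₗ xs → z ∈ₗ ys) →
                   length xs ≤ length ys
unique-⊆⇒length≤ {xs = []} _ _ = z≤n
unique-⊆⇒length≤ {xs = x ∷ xs} {ys} (x≢xs ∷ u) xs⊆ys = begin
  suc (length xs)           ≤⟨ s≤s (unique-⊆⇒length≤ u xs⊆ys─x) ⟩
  suc (length (ys ─ₗ x∈ys)) ≡⟨ length-removeAt′ ys (index x∈ys) ⟨
  length ys                 ∎
  where
  open ≤-Reasoning
  x∈ys : x ∈ₗ ys
  x∈ys = xs⊆ys (here refl)
  xs⊆ys─x : ∀ {z} → z ∈ₗ xs → z ∈ₗ (ys ─ₗ x∈ys)
  xs⊆ys─x z∈xs = ∈-─⁺ x∈ys (xs⊆ys (there z∈xs)) (≢-sym (All.lookup x≢xs z∈xs))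

_∖_ : List ℕ → List ℕ → List ℕ
xs ∖ ys = filter (λ c → ¬? (c ∈ₗ? ys)) xs

length-∖-split : ∀ xs ys → length xs ≡ length (xs ∖ ys) + length (filter (_∈ₗ? ys) xs)
length-∖-split []       ys = refl
length-∖-split (x ∷ xs) ys with x ∈ₗ? ys
... | yes _ = trans (cong suc (length-∖-split xs ys)) (sym (+-suc _ _))
... | no  _ = cong suc (length-∖-split xs ys)

length≤length-∖+length : ∀ {xs ys zs} → Unique xs → (∀ {c} → c ∈ₗ xs → c ∈ₗ ys → c ∈ₗ zs) →
                         length xs ≤ length (xs ∖ ys) + length zs
length≤length-∖+length {xs} {ys} {zs} u removed⊆zs = begin
  length xs                                          ≡⟨ length-∖-split xs ys ⟩
  length (xs ∖ ys) + length (filter (_∈ₗ? ys) xs)  ≤⟨ +-monoʳ-≤ (length (xs ∖ ys)) removed≤zs ⟩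
  length (xs ∖ ys) + length zs                       ∎
  where
  open ≤-Reasoning
  removed≤zs : length (filter (_∈ₗ? ys) xs) ≤ length zs
  removed≤zs = unique-⊆⇒length≤ (Unique.filter⁺ (_∈ₗ? ys) u)
                 (λ c∈ → let (c∈xs , c∈ys) = ∈-filter⁻ (_∈ₗ? ys) c∈ in removed⊆zs c∈xs c∈ys)

∃-∈-∉ : ∀ {xs ys} → Unique xs → length ys < length xs → ∃[ c ] c ∈ₗ xs × c ∉ₗ ys
∃-∈-∉ {xs} {ys} u ys<xs with xs ∖ ys in eq
... | [] = contradiction (subst (λ r → length xs ≤ length r + length ys) eq (length≤length-∖+length u (λ _ c∈ys → c∈ys)))
                         (<⇒≱ ys<xs)
... | c ∷ _ = c , ∈-filter⁻ (λ c → ¬? (c ∈ₗ? ys)) (subst (c ∈ₗ_) (sym eq) (here refl))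

∃-∈-of-length : ∀ {xs : List ℕ} → 0 < length xs → ∃[ a ] a ∈ₗ xs
∃-∈-of-length {a ∷ _} _ = a , here refl

length≡2⇒ : ∀ {xs : List ℕ} → length xs ≡ 2 → ∃[ a ] ∃[ b ] xs ≡ a ∷ b ∷ []
length≡2⇒ {[]}              ()
length≡2⇒ {_ ∷ []}          ()
length≡2⇒ {a ∷ b ∷ []}      refl = a , b , refl
length≡2⇒ {_ ∷ _ ∷ _ ∷ _}   ()

choices : ∀ {k} → (Fin k → List ℕ) → List (Vec ℕ k)
choices {zero}  Ls = [] ∷ []
choices {suc k} Ls = cartesianProductWith _∷_ (Ls zero) (choices (Ls ∘ suc))

∈-choices : ∀ {k} (Ls : Fin k → List ℕ) (cs : Vec ℕ k) → (∀ i → lookup cs i ∈ₗ Ls i) → cs ∈ₗ choices Ls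
∈-choices {zero}  Ls []       _   = here refl
∈-choices {suc k} Ls (c ∷ cs) cs∈ = ∈-cartesianProductWith⁺ _∷_ (cs∈ zero) (∈-choices (Ls ∘ suc) cs (cs∈ ∘ suc))

-- Natural numbers

∃-minimal : {A : Set} (μ : A → ℕ) {P : A → Set} → (∀ k → Dec (∃[ a ] P a × μ a < k)) →
          ∀ {a} → P a → ∃[ b ] P b × (∀ {c} → P c → μ b ≤ μ c)
∃-minimal μ {P} smaller? {a} Pa = go (μ a) Pa ≤-refl
  where
  go : ∀ k {a} → P a → μ a ≤ k → ∃[ b ] P b × (∀ {c} → P c → μ b ≤ μ c)
  go k {a} Pa _ with smaller? (μ a)
  go k       Pa _     | no ¬smaller = _ , Pa , λ Pc → ≮⇒≥ (λ μc<μa → ¬smaller (_ , Pc , μc<μa))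
  go zero    Pa μa≤0 | yes (_ , _ , μb<μa) = contradiction (≤-trans μb<μa μa≤0) λ ()
  go (suc k) Pa μa≤k | yes (_ , Pb , μb<μa) = go k Pb (≤-pred (≤-trans μb<μa μa≤k))

odd⇒≡3+2* : ∀ j → parity j ≡ 1ℙ → 3 ≤ j → ∃[ m ] j ≡ 3 + 2 * m
odd⇒≡3+2* 1 _ (s≤s ())
odd⇒≡3+2* 3 _ _ = 0 , refl
odd⇒≡3+2* (suc (suc (suc (suc (suc j))))) odd _ with odd⇒≡3+2* (3 + j) odd (s≤s (s≤s (s≤s z≤n)))
... | m , j≡ = suc m , trans (cong (λ k → 2 + k) j≡) (cong (λ k → 3 + k) (sym (*-suc 2 m)))

parity-suc≢ : ∀ i → parity (suc i) ≢ parity i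
parity-suc≢ i eq = p≢p⁻¹ (parity (suc i)) (trans eq (sym (suc-homo-⁻¹ i)))

-- Finite subsets

private variable
  p q : Subset m
  x y : Fin m

x∈p─q⇒x∉q : ∀ (p q : Subset m) → x ∈ p ─ q → x ∉ q
x∈p─q⇒x∉q {x = zero}  (true ∷ p) (false ∷ q) here ()
x∈p─q⇒x∉q {x = suc x} (_ ∷ p)    (_ ∷ q)     (there x∈p─q) (there x∈q) = x∈p─q⇒x∉q p q x∈p─q x∈q

x∈p─q⁻ : ∀ (p q : Subset m) → x ∈ p ─ q → x ∈ p × x ∉ q
x∈p─q⁻ p q x∈p─q = p─q⊆p p q x∈p─q , x∈p─q⇒x∉q p q x∈p─q

x∈p-y⁻ : ∀ (p : Subset m) → x ∈ p - y → x ∈ p × x ≢ y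
x∈p-y⁻ {y = y} p x∈p-y = p─q⊆p p ⁅ y ⁆ x∈p-y , λ { refl → x∈p─q⇒x∉q p ⁅ y ⁆ x∈p-y (x∈⁅x⁆ y) }

x∈p-y-z⁺ : ∀ {p : Subset m} {x y z} → x ∈ p → x ≢ y → x ≢ z → x ∈ p - y - z
x∈p-y-z⁺ x∈p x≢y x≢z = x∈p∧x≢y⇒x∈p-y (x∈p∧x≢y⇒x∈p-y x∈p x≢y) x≢z

x∈p-y-z⁻ : ∀ (p : Subset m) {x y z} → x ∈ p - y - z → x ∈ p × x ≢ y × x ≢ z
x∈p-y-z⁻ p {y = y} x∈ = let (x∈p-y , x≢z) = x∈p-y⁻ (p - y) x∈ ; (x∈p , x≢y) = x∈p-y⁻ p x∈p-y in x∈p , x≢y , x≢z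

p⊆p─q∪q : ∀ (p q : Subset m) → p ⊆ (p ─ q) ∪ q
p⊆p─q∪q p q {x} x∈p with x ∈? q
... | yes x∈q = x∈p∪q⁺ (inj₂ x∈q)
... | no  x∉q = x∈p∪q⁺ (inj₁ (x∈p∧x∉q⇒x∈p─q x∈p x∉q))

x∈⁅y⁆∪⁅z⁆⁻ : ∀ {x} (y z : Fin m) → x ∈ ⁅ y ⁆ ∪ ⁅ z ⁆ → x ≡ y ⊎ x ≡ z
x∈⁅y⁆∪⁅z⁆⁻ y z x∈ with x∈p∪q⁻ ⁅ y ⁆ ⁅ z ⁆ x∈
... | inj₁ x∈⁅y⁆ = inj₁ (x∈⁅y⁆⇒x≡y y x∈⁅y⁆)
... | inj₂ x∈⁅z⁆ = inj₂ (x∈⁅y⁆⇒x≡y z x∈⁅z⁆)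

∣p∣≡∣p∩q∣+∣p─q∣ : ∀ (p q : Subset m) → ∣ p ∣ ≡ ∣ p ∩ q ∣ + ∣ p ─ q ∣
∣p∣≡∣p∩q∣+∣p─q∣ []          []          = refl
∣p∣≡∣p∩q∣+∣p─q∣ (true  ∷ p) (true  ∷ q) = cong suc (∣p∣≡∣p∩q∣+∣p─q∣ p q)
∣p∣≡∣p∩q∣+∣p─q∣ (true  ∷ p) (false ∷ q) = trans (cong suc (∣p∣≡∣p∩q∣+∣p─q∣ p q)) (sym (+-suc _ _))
∣p∣≡∣p∩q∣+∣p─q∣ (false ∷ p) (true  ∷ q) = ∣p∣≡∣p∩q∣+∣p─q∣ p q
∣p∣≡∣p∩q∣+∣p─q∣ (false ∷ p) (false ∷ q) = ∣p∣≡∣p∩q∣+∣p─q∣ p q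

∣p∪q∣≤∣p∣+∣q∣ : ∀ (p q : Subset m) → ∣ p ∪ q ∣ ≤ ∣ p ∣ + ∣ q ∣
∣p∪q∣≤∣p∣+∣q∣ p q = begin
  ∣ p ∪ q ∣                         ≡⟨ ∣p∣≡∣p∩q∣+∣p─q∣ (p ∪ q) p ⟩
  ∣ (p ∪ q) ∩ p ∣ + ∣ (p ∪ q) ─ p ∣ ≤⟨ +-mono-≤ (p⊆q⇒∣p∣≤∣q∣ (p∩q⊆q (p ∪ q) p)) (p⊆q⇒∣p∣≤∣q∣ ⊆q) ⟩
  ∣ p ∣ + ∣ q ∣                     ∎
  where
  open ≤-Reasoning
  ⊆q : (p ∪ q) ─ p ⊆ q
  ⊆q x∈ with x∈p─q⁻ (p ∪ q) p x∈
  ... | x∈p∪q , x∉p with x∈p∪q⁻ p q x∈p∪q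
  ...   | inj₁ x∈p = contradiction x∈p x∉p
  ...   | inj₂ x∈q = x∈q

⊆⁅x⁆∪⁅y⁆⇒∣p∣≤2 : (∀ {z} → z ∈ p → z ≡ x ⊎ z ≡ y) → ∣ p ∣ ≤ 2
⊆⁅x⁆∪⁅y⁆⇒∣p∣≤2 {p = p} {x = x} {y = y} p⊆ = begin
  ∣ p ∣             ≤⟨ p⊆q⇒∣p∣≤∣q∣ (x∈p∪q⁺ ∘ ∈⁅⁆ ∘ p⊆) ⟩
  ∣ ⁅ x ⁆ ∪ ⁅ y ⁆ ∣ ≤⟨ ∣p∪q∣≤∣p∣+∣q∣ ⁅ x ⁆ ⁅ y ⁆ ⟩
  ∣ ⁅ x ⁆ ∣ + ∣ ⁅ y ⁆ ∣ ≡⟨ cong₂ _+_ (∣⁅x⁆∣≡1 x) (∣⁅x⁆∣≡1 y) ⟩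
  2                 ∎
  where
  open ≤-Reasoning
  ∈⁅⁆ : ∀ {z} → z ≡ x ⊎ z ≡ y → z ∈ ⁅ x ⁆ ⊎ z ∈ ⁅ y ⁆
  ∈⁅⁆ (inj₁ refl) = inj₁ (x∈⁅x⁆ x)
  ∈⁅⁆ (inj₂ refl) = inj₂ (x∈⁅x⁆ y)

x∈p⇒0<∣p∣ : x ∈ p → 0 < ∣ p ∣
x∈p⇒0<∣p∣ x∈p = ≤-<-trans z≤n (x∈p⇒∣p-x∣<∣p∣ x∈p)

distinct⇒2≤∣p∣ : ∀ {x y : Fin m} → x ∈ p → y ∈ p → x ≢ y → 2 ≤ ∣ p ∣
distinct⇒2≤∣p∣ x∈p y∈p x≢y =
  ≤-trans (s≤s (x∈p⇒0<∣p∣ (x∈p∧x≢y⇒x∈p-y y∈p (≢-sym x≢y)))) (x∈p⇒∣p-x∣<∣p∣ x∈p)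

distinct⇒3≤∣p∣ : ∀ {x y z : Fin m} → x ∈ p → y ∈ p → z ∈ p → x ≢ y → x ≢ z → y ≢ z → 3 ≤ ∣ p ∣
distinct⇒3≤∣p∣ x∈p y∈p z∈p x≢y x≢z y≢z =
  ≤-trans (s≤s (distinct⇒2≤∣p∣ (x∈p∧x≢y⇒x∈p-y y∈p (≢-sym x≢y)) (x∈p∧x≢y⇒x∈p-y z∈p (≢-sym x≢z)) y≢z))
          (x∈p⇒∣p-x∣<∣p∣ x∈p)

∈-tabulate⁺ : ∀ {f : Fin m → Bool} → f x ≡ true → x ∈ tabulate f
∈-tabulate⁺ {x = x} {f} fx = lookup⇒[]= x (tabulate f) (trans (lookup∘tabulate f x) fx)

∈-tabulate⁻ : ∀ {f : Fin m → Bool} → x ∈ tabulate f → f x ≡ true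
∈-tabulate⁻ {x = x} {f} x∈ = trans (sym (lookup∘tabulate f x)) ([]=⇒lookup x∈)

select : {P : Fin m → Set} → Decidable P → Subset m
select P? = tabulate (does ∘ P?)

∈-select⁺ : ∀ {P : Fin m → Set} (P? : Decidable P) → P x → x ∈ select P?
∈-select⁺ {x = x} P? Px = ∈-tabulate⁺ (dec-true (P? x) Px)

∈-select⁻ : ∀ {P : Fin m → Set} (P? : Decidable P) → x ∈ select P? → P x
∈-select⁻ {x = x} P? x∈ with P? x | ∈-tabulate⁻ {f = does ∘ P?} x∈
... | yes Px | _ = Px

elements : Subset m → List (Fin m)
elements []          = []
elements (true ∷ p)  = zero ∷ map suc (elements p)
elements (false ∷ p) = map suc (elements p)

length-elements : ∀ (p : Subset m) → length (elements p) ≡ ∣ p ∣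
length-elements []          = refl
length-elements (true ∷ p)  = cong suc (trans (length-map suc (elements p)) (length-elements p))
length-elements (false ∷ p) = trans (length-map suc (elements p)) (length-elements p)

∈-elements : ∀ (p : Subset m) → x ∈ p → x ∈ₗ elements p
∈-elements (true ∷ p)  here         = here refl
∈-elements (true ∷ p)  (there x∈p)  = there (∈-map⁺ suc (∈-elements p x∈p))
∈-elements (false ∷ p) (there x∈p)  = ∈-map⁺ suc (∈-elements p x∈p)

module ListColouring {n : ℕ} (G : Graph n) where

  infix 4 _~_
  _~_ : Fin n → Fin n → Set
  u ~ v = adj G u v ≡ true

  private variable
    s u v w : Fin n
    S T W X Y Z B K P Q : Subset n
    L : Fin n → List ℕ

  _~?_ : ∀ u v → Dec (u ~ v)
  u ~? v = adj G u v ≟ᵇ true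

  ~-sym : u ~ v → v ~ u
  ~-sym {u} {v} u~v = trans (Graph.sym G v u) u~v

  ~-irrefl : ¬ (v ~ v)
  ~-irrefl {v} v~v with trans (sym (irrfl G v)) v~v
  ... | ()

  ~⇒≢ : u ~ v → u ≢ v
  ~⇒≢ u~v refl = ~-irrefl u~v

  ∈-nbhd⁺ : v ~ w → w ∈ nbhd G v
  ∈-nbhd⁺ = ∈-tabulate⁺

  ∈-nbhd⁻ : w ∈ nbhd G v → v ~ w
  ∈-nbhd⁻ = ∈-tabulate⁻

  ∈-∩nbhd⁺ : u ∈ S → v ~ u → u ∈ S ∩ nbhd G v
  ∈-∩nbhd⁺ u∈S v~u = x∈p∩q⁺ (u∈S , ∈-nbhd⁺ v~u)

  ∩nbhd-mono : S ⊆ T → S ∩ nbhd G w ⊆ T ∩ nbhd G w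
  ∩nbhd-mono S⊆T x∈ = let (x∈S , x∈N) = x∈p∩q⁻ _ _ x∈ in x∈p∩q⁺ (S⊆T x∈S , x∈N)

  degIn-mono : S ⊆ T → degIn G S w ≤ degIn G T w
  degIn-mono S⊆T = p⊆q⇒∣p∣≤∣q∣ (∩nbhd-mono S⊆T)

  degIn-< : S ⊆ T → u ∈ T → u ∉ S → w ~ u → degIn G S w < degIn G T w
  degIn-< S⊆T u∈T u∉S w~u =
    p⊂q⇒∣p∣<∣q∣ (∩nbhd-mono S⊆T , _ , ∈-∩nbhd⁺ u∈T w~u , u∉S ∘ proj₁ ∘ x∈p∩q⁻ _ _)

  degIn-split : K ⊆ B → degIn G B w ≡ degIn G (B ─ K) w + degIn G K w
  degIn-split {K} {B} {w} K⊆B = begin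
    ∣ B ∩ N ∣                         ≡⟨ ∣p∣≡∣p∩q∣+∣p─q∣ (B ∩ N) K ⟩
    ∣ (B ∩ N) ∩ K ∣ + ∣ (B ∩ N) ─ K ∣ ≡⟨ cong₂ _+_ (cong ∣_∣ inside) (cong ∣_∣ outside) ⟩
    ∣ K ∩ N ∣ + ∣ (B ─ K) ∩ N ∣       ≡⟨ +-comm ∣ K ∩ N ∣ _ ⟩
    ∣ (B ─ K) ∩ N ∣ + ∣ K ∩ N ∣       ∎
    where
    open ≡-Reasoning
    N : Subset n
    N = nbhd G w
    inside : (B ∩ N) ∩ K ≡ K ∩ N
    inside = ⊆-antisym
      (λ x∈ → let (x∈B∩N , x∈K) = x∈p∩q⁻ _ _ x∈ in x∈p∩q⁺ (x∈K , p∩q⊆q B N x∈B∩N))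
      (λ x∈ → let (x∈K , x∈N) = x∈p∩q⁻ _ _ x∈ in x∈p∩q⁺ (x∈p∩q⁺ (K⊆B x∈K , x∈N) , x∈K))
    outside : (B ∩ N) ─ K ≡ (B ─ K) ∩ N
    outside = ⊆-antisym
      (λ x∈ → let (x∈B∩N , x∉K) = x∈p─q⁻ _ _ x∈ ; (x∈B , x∈N) = x∈p∩q⁻ _ _ x∈B∩N in
              x∈p∩q⁺ (x∈p∧x∉q⇒x∈p─q x∈B x∉K , x∈N))
      (λ x∈ → let (x∈B─K , x∈N) = x∈p∩q⁻ _ _ x∈ ; (x∈B , x∉K) = x∈p─q⁻ _ _ x∈B─K in
              x∈p∧x∉q⇒x∈p─q (x∈p∩q⁺ (x∈B , x∈N)) x∉K)

  degIn-⊤ : degIn G ⊤ w ≡ deg G w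
  degIn-⊤ {w} = cong ∣_∣ (∩-identityˡ (nbhd G w))

  record Colouring (S : Subset n) (L : Fin n → List ℕ) : Set where
    field
      colour  : Fin n → ℕ
      in-list : ∀ {v} → v ∈ S → colour v ∈ₗ L v
      proper  : ∀ {u v} → u ∈ S → v ∈ S → u ~ v → colour u ≢ colour v
  open Colouring public

  UniqueLists : (Fin n → List ℕ) → Set
  UniqueLists L = ∀ v → Unique (L v)

  DegreeBounded : Subset n → (Fin n → List ℕ) → Set
  DegreeBounded S L = ∀ {v} → v ∈ S → degIn G S v ≤ length (L v)

  Tight : Subset n → (Fin n → List ℕ) → Set
  Tight S L = ∀ {v} → v ∈ S → length (L v) ≡ degIn G S v

  restrict : T ⊆ S → Colouring S L → Colouring T L
  restrict T⊆S c = record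
    { colour = colour c ; in-list = in-list c ∘ T⊆S ; proper = λ u∈T v∈T → proper c (T⊆S u∈T) (T⊆S v∈T) }

  colouring-empty : Empty S → Colouring S L
  colouring-empty S≡∅ = record
    { colour  = const 0
    ; in-list = λ {v} v∈S → ⊥-elim (S≡∅ (v , v∈S))
    ; proper  = λ {u} u∈S → ⊥-elim (S≡∅ (u , u∈S))
    }

  colouring-const : ∀ {a} → (∀ {v} → v ∈ K → a ∈ₗ L v) → (∀ {u v} → u ∈ K → v ∈ K → ¬ u ~ v) → Colouring K L
  colouring-const {a = a} a∈L independent =
    record { colour = const a ; in-list = a∈L ; proper = λ u∈K v∈K u~v _ → independent u∈K v∈K u~v }

  usedColours : (Fin n → ℕ) → Subset n → Fin n → List ℕ
  usedColours φ K w = map φ (elements (K ∩ nbhd G w))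

  length-usedColours : ∀ φ K w → length (usedColours φ K w) ≡ degIn G K w
  length-usedColours φ K w = trans (length-map φ (elements (K ∩ nbhd G w))) (length-elements (K ∩ nbhd G w))

  ∈-usedColours : ∀ φ → u ∈ K → w ~ u → φ u ∈ₗ usedColours φ K w
  ∈-usedColours φ u∈K w~u = ∈-map⁺ φ (∈-elements _ (∈-∩nbhd⁺ u∈K w~u))

  extend-colouring : UniqueLists L → degIn G (X - s) s < length (L s) → Colouring (X - s) L → Colouring X L
  extend-colouring {L} {X} {s} U deg<len c
    with ∃-∈-∉ (U s) (subst (_< length (L s)) (sym (length-usedColours (colour c) (X - s) s)) deg<len)
  ... | a , a∈Ls , a-unused = record { colour = φ ; in-list = φ-in-list ; proper = φ-proper }
    where
    φ : Fin n → ℕ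
    φ w with w ≟ᶠ s
    ... | yes _ = a
    ... | no  _ = colour c w

    a-fresh : u ∈ X - s → s ~ u → a ≢ colour c u
    a-fresh u∈ s~u refl = a-unused (∈-usedColours (colour c) u∈ s~u)

    φ-in-list : v ∈ X → φ v ∈ₗ L v
    φ-in-list {v} v∈X with v ≟ᶠ s
    ... | yes refl = a∈Ls
    ... | no  v≢s  = in-list c (x∈p∧x≢y⇒x∈p-y v∈X v≢s)

    φ-proper : u ∈ X → v ∈ X → u ~ v → φ u ≢ φ v
    φ-proper {u} {v} u∈X v∈X u~v with u ≟ᶠ s | v ≟ᶠ s
    ... | yes refl | yes refl = contradiction u~v ~-irrefl
    ... | yes refl | no v≢s   = a-fresh (x∈p∧x≢y⇒x∈p-y v∈X v≢s) u~v
    ... | no u≢s   | yes refl = ≢-sym (a-fresh (x∈p∧x≢y⇒x∈p-y u∈X u≢s) (~-sym u~v))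
    ... | no u≢s   | no v≢s   = proper c (x∈p∧x≢y⇒x∈p-y u∈X u≢s) (x∈p∧x≢y⇒x∈p-y v∈X v≢s) u~v

  Closed : Subset n → Subset n → Set
  Closed Z W = ∀ {x y} → x ∈ Z → y ∈ W → x ~ y → y ∈ Z

  closed? : ∀ Z W → Dec (Closed Z W)
  closed? Z W = map′ (λ closed {x} {y} → closed x y) (λ closed x y → closed)
    (all? λ x → all? λ y → (x ∈? Z) →-dec ((y ∈? W) →-dec ((x ~? y) →-dec (y ∈? Z))))

  SlackInEveryComponent : Subset n → (Fin n → List ℕ) → Set
  SlackInEveryComponent X L =
    ∀ {Z} → Z ⊆ X → Nonempty Z → Closed Z X → ∃[ s ] s ∈ Z × degIn G X s < length (L s)

  greedy-colouring : UniqueLists L → DegreeBounded X L → SlackInEveryComponent X L → Colouring X L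
  greedy-colouring {L} {X} = go ∣ X ∣ ≤-refl
    where
    go : ∀ k {X} → ∣ X ∣ ≤ k → UniqueLists L → DegreeBounded X L → SlackInEveryComponent X L → Colouring X L
    go k {X} _ _ _ _ with nonempty? X
    go k       _     _ _       _     | no X≡∅ = colouring-empty X≡∅
    go zero    |X|≤0 _ _       _     | yes (_ , x∈X) = contradiction |X|≤0 (<⇒≱ (x∈p⇒0<∣p∣ x∈X))
    go (suc k) {X} |X|≤k U bounded slack | yes X≢∅ with slack (λ x∈X → x∈X) X≢∅ (λ _ y∈X _ → y∈X)
    ... | s , s∈X , s-slack =
      extend-colouring U (≤-<-trans (degIn-mono X-s⊆X) s-slack) (go k |X-s|≤k U bounded′ slack′)
      where
      X-s⊆X : X - s ⊆ X
      X-s⊆X = p─q⊆p X ⁅ s ⁆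
      |X-s|≤k : ∣ X - s ∣ ≤ k
      |X-s|≤k = ≤-pred (≤-trans (x∈p⇒∣p-x∣<∣p∣ s∈X) |X|≤k)
      bounded′ : DegreeBounded (X - s) L
      bounded′ v∈ = ≤-trans (degIn-mono X-s⊆X) (bounded (X-s⊆X v∈))
      slack′ : SlackInEveryComponent (X - s) L
      slack′ {Z} Z⊆ Z≢∅ Z-closed with any? (λ w → (w ∈? Z) ×-dec (s ~? w))
      ... | yes (w , w∈Z , s~w) =
        w , w∈Z , <-≤-trans (degIn-< X-s⊆X s∈X (λ s∈ → proj₂ (x∈p-y⁻ X s∈) refl) (~-sym s~w)) (bounded (X-s⊆X (Z⊆ w∈Z)))
      ... | no ¬s~Z with slack (X-s⊆X ∘ Z⊆) Z≢∅ closed-in-X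
        where
        closed-in-X : Closed Z X
        closed-in-X {x} {y} x∈Z y∈X x~y with y ≟ᶠ s
        ... | yes refl = contradiction (x , x∈Z , ~-sym x~y) ¬s~Z
        ... | no y≢s   = Z-closed x∈Z (x∈p∧x≢y⇒x∈p-y y∈X y≢s) x~y
      ... | t , t∈Z , t-slack = t , t∈Z , ≤-<-trans (degIn-mono X-s⊆X) t-slack

  residual : (Fin n → List ℕ) → (Fin n → ℕ) → Subset n → Fin n → List ℕ
  residual L φ K w = L w ∖ usedColours φ K w

  residual-unique : UniqueLists L → ∀ φ K → UniqueLists (residual L φ K)
  residual-unique U φ K w = Unique.filter⁺ _ (U w)

  length≤length-residual+degIn : UniqueLists L → ∀ φ K w → length (L w) ≤ length (residual L φ K w) + degIn G K w
  length≤length-residual+degIn {L} U φ K w =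
    subst (λ d → length (L w) ≤ length (residual L φ K w) + d) (length-usedColours φ K w)
          (length≤length-∖+length (U w) (λ _ c∈used → c∈used))

  ≤-length-residual : UniqueLists L → ∀ φ → length (L w) ≡ degIn G X w + degIn G K w →
                      degIn G X w ≤ length (residual L φ K w)
  ≤-length-residual {L} {w} {X} {K} U φ split = +-cancelʳ-≤ (degIn G K w) (degIn G X w) (length (residual L φ K w))
    (subst (_≤ length (residual L φ K w) + degIn G K w) split (length≤length-residual+degIn U φ K w))

  ∈-usedColours-const⁻ : ∀ {a c} → c ∈ₗ usedColours (const a) K w → c ≡ a
  ∈-usedColours-const⁻ c∈ = let (_ , _ , c≡a) = ∈-map⁻ _ c∈ in c≡a

  private
    merge : Subset n → (Fin n → ℕ) → (Fin n → ℕ) → Fin n → ℕ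
    merge K ψ φ w with w ∈? K
    ... | yes _ = ψ w
    ... | no  _ = φ w

    ∈-∪-∉ : v ∈ P ∪ Q → v ∉ Q → v ∈ P
    ∈-∪-∉ {P = P} {Q} v∈ v∉Q with x∈p∪q⁻ P Q v∈
    ... | inj₁ v∈P = v∈P
    ... | inj₂ v∈Q = contradiction v∈Q v∉Q

  colouring-∪-residual : (c : Colouring K L) → Colouring X (residual L (colour c) K) → Colouring (X ∪ K) L
  colouring-∪-residual {K} {L} {X} c d = record
    { colour = merge K (colour c) (colour d) ; in-list = merged-in-list ; proper = merged-proper }
    where
    fresh : u ∈ K → v ∈ X → u ~ v → colour c u ≢ colour d v
    fresh {u} {v} u∈K v∈X u~v c≡d = proj₂ (∈-filter⁻ _ {xs = L v} (in-list d v∈X))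
      (subst (_∈ₗ usedColours (colour c) K v) c≡d (∈-usedColours (colour c) u∈K (~-sym u~v)))

    merged-in-list : v ∈ X ∪ K → merge K (colour c) (colour d) v ∈ₗ L v
    merged-in-list {v} v∈ with v ∈? K
    ... | yes v∈K = in-list c v∈K
    ... | no  v∉K = proj₁ (∈-filter⁻ _ (in-list d (∈-∪-∉ v∈ v∉K)))

    merged-proper : u ∈ X ∪ K → v ∈ X ∪ K → u ~ v → merge K (colour c) (colour d) u ≢ merge K (colour c) (colour d) v
    merged-proper {u} {v} u∈ v∈ u~v with u ∈? K | v ∈? K
    ... | yes u∈K | yes v∈K = proper c u∈K v∈K u~v
    ... | yes u∈K | no  v∉K = fresh u∈K (∈-∪-∉ v∈ v∉K) u~v
    ... | no  u∉K | yes v∈K = ≢-sym (fresh v∈K (∈-∪-∉ u∈ u∉K) (~-sym u~v))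
    ... | no  u∉K | no  v∉K = proper d (∈-∪-∉ u∈ u∉K) (∈-∪-∉ v∈ v∉K) u~v

  colouring-∪-separated : (∀ {u v} → u ∈ P → v ∈ Q → ¬ u ~ v) → Colouring P L → Colouring Q L → Colouring (Q ∪ P) L
  colouring-∪-separated {P} {Q} {L} separated c d = record
    { colour = merge P (colour c) (colour d) ; in-list = merged-in-list ; proper = merged-proper }
    where
    merged-in-list : v ∈ Q ∪ P → merge P (colour c) (colour d) v ∈ₗ L v
    merged-in-list {v} v∈ with v ∈? P
    ... | yes v∈P = in-list c v∈P
    ... | no  v∉P = in-list d (∈-∪-∉ v∈ v∉P)

    merged-proper : u ∈ Q ∪ P → v ∈ Q ∪ P → u ~ v → merge P (colour c) (colour d) u ≢ merge P (colour c) (colour d) v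
    merged-proper {u} {v} u∈ v∈ u~v with u ∈? P | v ∈? P
    ... | yes u∈P | yes v∈P = proper c u∈P v∈P u~v
    ... | yes u∈P | no  v∉P = contradiction u~v (separated u∈P (∈-∪-∉ v∈ v∉P))
    ... | no  u∉P | yes v∈P = contradiction (~-sym u~v) (separated v∈P (∈-∪-∉ u∈ u∉P))
    ... | no  u∉P | no  v∉P = proper d (∈-∪-∉ u∈ u∉P) (∈-∪-∉ v∈ v∉P) u~v

  private
    Valid : Subset n → (Fin n → List ℕ) → Vec ℕ n → Set
    Valid S L cs = (∀ v → v ∈ S → lookup cs v ∈ₗ L v) ×
                   (∀ u v → u ∈ S → v ∈ S → u ~ v → lookup cs u ≢ lookup cs v)

    valid? : ∀ S L cs → Dec (Valid S L cs)
    valid? S L cs =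
      all? (λ v → (v ∈? S) →-dec (lookup cs v ∈ₗ? L v)) ×-dec
      all? (λ u → all? (λ v → (u ∈? S) →-dec ((v ∈? S) →-dec ((u ~? v) →-dec ¬? (lookup cs u ≟ℕ lookup cs v)))))

    -- Colours outside S are irrelevant; they are set to 0, which is why the search
    -- ranges over the lists 0 ∷ L v.
    padded : Subset n → (Fin n → ℕ) → Fin n → ℕ
    padded S φ v with v ∈? S
    ... | yes _ = φ v
    ... | no  _ = 0

    lookup-padded : ∀ φ → v ∈ S → lookup (tabulate (padded S φ)) v ≡ φ v
    lookup-padded {v} {S} φ v∈S with lookup (tabulate (padded S φ)) v | lookup∘tabulate (padded S φ) v
    ... | _ | refl with v ∈? S
    ...   | yes _   = refl
    ...   | no  v∉S = contradiction v∈S v∉S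

    padded-∈ : ∀ (c : Colouring S L) v → lookup (tabulate (padded S (colour c))) v ∈ₗ (0 ∷ L v)
    padded-∈ {S} c v rewrite lookup∘tabulate (padded S (colour c)) v with v ∈? S
    ... | yes v∈S = there (in-list c v∈S)
    ... | no  _   = here refl

  colouring? : ∀ S L → Dec (Colouring S L)
  colouring? S L with Any.any? (valid? S L) (choices (λ v → 0 ∷ L v))
  ... | yes ∃valid = let (cs , cs-in-list , cs-proper) = Any.satisfied ∃valid in
    yes record { colour = lookup cs ; in-list = cs-in-list _ ; proper = cs-proper _ _ }
  ... | no ¬∃valid = no λ c → ¬∃valid (Any.map (λ { refl → valid c })
                                         (∈-choices _ (tabulate (padded S (colour c))) (padded-∈ c)))
    where
    valid : (c : Colouring S L) → Valid S L (tabulate (padded S (colour c)))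
    valid c = (λ v v∈S → subst (_∈ₗ L v) (sym (lookup-padded (colour c) v∈S)) (in-list c v∈S))
            , (λ u v u∈S v∈S u~v eq → proper c u∈S v∈S u~v
                (trans (sym (lookup-padded (colour c) u∈S)) (trans eq (lookup-padded (colour c) v∈S))))

  -- Equivalent to the walk-based Connected (see below), but closed parts can be built
  -- by comprehension, which makes it the convenient form inside proofs.
  Connectedᶜ : Subset n → Set
  Connectedᶜ W = ∀ {Z} → Z ⊆ W → Nonempty Z → Closed Z W → W ⊆ Z

  ─-closed : Closed Z W → Closed (W ─ Z) W
  ─-closed {Z} {W} Z-closed {x} {y} x∈ y∈W x~y with y ∈? Z
  ... | yes y∈Z = let (x∈W , x∉Z) = x∈p─q⁻ W Z x∈ in contradiction (Z-closed y∈Z x∈W (~-sym x~y)) x∉Z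
  ... | no  y∉Z = x∈p∧x∉q⇒x∈p─q y∈W y∉Z

  reach-closed : Closed Z S → u ∈ Z → Reach G S u v → v ∈ Z
  reach-closed Z-closed u∈Z here                = u∈Z
  reach-closed Z-closed u∈Z (step u~w w∈S walk) = reach-closed Z-closed (Z-closed u∈Z w∈S u~w) walk

  Connected⇒Connectedᶜ : Connected G W → Connectedᶜ W
  Connected⇒Connectedᶜ conn Z⊆W (z , z∈Z) Z-closed v∈W = reach-closed Z-closed z∈Z (conn _ _ (Z⊆W z∈Z) v∈W)

  module Reachable (S : Subset n) (a : Fin n) where

    Grown : Subset n → Fin n → Set
    Grown Z y = y ∈ Z ⊎ (y ∈ S × ∃[ x ] x ∈ Z × x ~ y)

    grown? : ∀ Z → Decidable (Grown Z)
    grown? Z y = (y ∈? Z) ⊎-dec ((y ∈? S) ×-dec any? (λ x → (x ∈? Z) ×-dec (x ~? y)))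

    grow : Subset n → Subset n
    grow Z = select (grown? Z)

    layer : ℕ → Subset n
    layer zero    = ⁅ a ⁆
    layer (suc k) = grow (layer k)

    layer-⊆-suc : ∀ k → layer k ⊆ layer (suc k)
    layer-⊆-suc k y∈ = ∈-select⁺ (grown? (layer k)) (inj₁ y∈)

    snoc : Reach G S u v → v ~ w → w ∈ S → Reach G S u w
    snoc here                v~w w∈S = step v~w w∈S here
    snoc (step u~x x∈S walk) v~w w∈S = step u~x x∈S (snoc walk v~w w∈S)

    reach-layer : ∀ k → v ∈ layer k → Reach G S a v
    reach-layer zero    v∈ with x∈⁅y⁆⇒x≡y a v∈
    ... | refl = here
    reach-layer (suc k) v∈ with ∈-select⁻ (grown? (layer k)) v∈
    ... | inj₁ v∈layer              = reach-layer k v∈layer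
    ... | inj₂ (v∈S , x , x∈ , x~v) = snoc (reach-layer k x∈) x~v v∈S

    a∈layer : ∀ k → a ∈ layer k
    a∈layer zero    = x∈⁅x⁆ a
    a∈layer (suc k) = layer-⊆-suc k (a∈layer k)

    layer⊆S : a ∈ S → ∀ k → layer k ⊆ S
    layer⊆S a∈S zero    v∈ with x∈⁅y⁆⇒x≡y a v∈
    ... | refl = a∈S
    layer⊆S a∈S (suc k) v∈ with ∈-select⁻ (grown? (layer k)) v∈
    ... | inj₁ v∈layer  = layer⊆S a∈S k v∈layer
    ... | inj₂ (v∈S , _) = v∈S

    closed-suc : ∀ k → Closed (layer k) S → Closed (layer (suc k)) S
    closed-suc k closed x∈ y∈S x~y with ∈-select⁻ (grown? (layer k)) x∈
    ... | inj₁ x∈layer                = layer-⊆-suc k (closed x∈layer y∈S x~y)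
    ... | inj₂ (x∈S , w , w∈layer , w~x) = layer-⊆-suc k (closed (closed w∈layer x∈S w~x) y∈S x~y)

    -- Layers grow strictly until one is closed, so layer n is closed.
    closed-or-large : ∀ k → Closed (layer k) S ⊎ k < ∣ layer k ∣
    closed-or-large zero = inj₂ (x∈p⇒0<∣p∣ (x∈⁅x⁆ a))
    closed-or-large (suc k) with closed-or-large k
    ... | inj₁ closed = inj₁ (closed-suc k closed)
    ... | inj₂ k<∣layer∣
      with any? (λ x → any? (λ y → (x ∈? layer k) ×-dec ((y ∈? S) ×-dec ((x ~? y) ×-dec ¬? (y ∈? layer k)))))
    ...   | yes (x , y , x∈ , y∈S , x~y , y∉) = inj₂ (≤-trans (s≤s k<∣layer∣)
      (p⊂q⇒∣p∣<∣q∣ (layer-⊆-suc k , y , ∈-select⁺ (grown? (layer k)) (inj₂ (y∈S , x , x∈ , x~y)) , y∉)))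
    ...   | no ¬escape = inj₁ (closed-suc k closed)
      where
      closed : Closed (layer k) S
      closed {x} {y} x∈ y∈S x~y with y ∈? layer k
      ... | yes y∈ = y∈
      ... | no  y∉ = contradiction (x , y , x∈ , y∈S , x~y , y∉) ¬escape

    reachable-closed : Closed (layer n) S
    reachable-closed with closed-or-large n
    ... | inj₁ closed = closed
    ... | inj₂ n<∣layer∣ = contradiction (∣p∣≤n (layer n)) (<⇒≱ n<∣layer∣)

  Connectedᶜ⇒Connected : Connectedᶜ W → Connected G W
  Connectedᶜ⇒Connected {W} conn a b a∈W b∈W =
    reach-layer n (conn (layer⊆S a∈W n) (a , a∈layer n) reachable-closed b∈W)
    where open Reachable W a

  connected⇒slack : Connectedᶜ X → w ∈ X → degIn G X w < length (L w) → SlackInEveryComponent X L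
  connected⇒slack connected w∈X w-slack Z⊆X Z≢∅ Z-closed = _ , connected Z⊆X Z≢∅ Z-closed w∈X , w-slack

  uncolourable⇒tight : UniqueLists L → Connectedᶜ S → DegreeBounded S L → ¬ Colouring S L → Tight S L
  uncolourable⇒tight {L} {S} U connected bounded uncolourable {w} w∈S with degIn G S w <? length (L w)
  ... | yes w-slack = ⊥-elim (uncolourable (greedy-colouring U bounded (connected⇒slack {L = L} connected w∈S w-slack)))
  ... | no  ¬slack  = ≤-antisym (≮⇒≥ ¬slack) (bounded w∈S)

  InducedP₃ : Subset n → Fin n → Fin n → Fin n → Set
  InducedP₃ B x y z = x ∈ B × y ∈ B × z ∈ B × x ~ y × x ~ z × y ≢ z × ¬ y ~ z

  private
    InClosedNbhd : Subset n → Fin n → Fin n → Set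
    InClosedNbhd B a v = v ∈ B × (v ≡ a ⊎ a ~ v)

    closedNbhd? : ∀ B a → Decidable (InClosedNbhd B a)
    closedNbhd? B a v = (v ∈? B) ×-dec ((v ≟ᶠ a) ⊎-dec (a ~? v))

    closedNbhd : Subset n → Fin n → Subset n
    closedNbhd B a = select (closedNbhd? B a)

  -- An edge u v leaving the closed neighbourhood of a gives the induced path a - u - v.
  non-edge⇒induced-P₃ : ∀ {a b} → Connectedᶜ B → a ∈ B → b ∈ B → a ≢ b → ¬ a ~ b →
                        ∃ λ x → ∃ λ y → ∃ λ z → InducedP₃ B x y z
  non-edge⇒induced-P₃ {B} {a} {b} B-connected a∈B b∈B a≢b a≁b
    with any? (λ u → any? (λ v → (u ∈? closedNbhd B a) ×-dec ((v ∈? B) ×-dec ((u ~? v) ×-dec ¬? (v ∈? closedNbhd B a)))))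
  ... | yes (u , v , u∈ , v∈B , u~v , v∉) with ∈-select⁻ (closedNbhd? B a) u∈
  ...   | _ , inj₁ refl = ⊥-elim (v∉ (∈-select⁺ (closedNbhd? B a) (v∈B , inj₂ u~v)))
  ...   | u∈B , inj₂ a~u =
    u , a , v , u∈B , a∈B , v∈B , ~-sym a~u , u~v ,
    (λ { refl → v∉ (∈-select⁺ (closedNbhd? B a) (a∈B , inj₁ refl)) }) ,
    (λ a~v → v∉ (∈-select⁺ (closedNbhd? B a) (v∈B , inj₂ a~v)))
  non-edge⇒induced-P₃ {B} {a} {b} B-connected a∈B b∈B a≢b a≁b | no ¬exit
    with proj₂ (∈-select⁻ (closedNbhd? B a) (B-connected ⊆B a∈ closed b∈B))
    where
    ⊆B : closedNbhd B a ⊆ B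
    ⊆B = proj₁ ∘ ∈-select⁻ (closedNbhd? B a)
    a∈ : Nonempty (closedNbhd B a)
    a∈ = a , ∈-select⁺ (closedNbhd? B a) (a∈B , inj₁ refl)
    closed : Closed (closedNbhd B a) B
    closed {u} {v} u∈ v∈B u~v with v ∈? closedNbhd B a
    ... | yes v∈ = v∈
    ... | no  v∉ = contradiction (u , v , u∈ , v∈B , u~v , v∉) ¬exit
  ... | inj₁ b≡a = contradiction (sym b≡a) a≢b
  ... | inj₂ a~b = contradiction a~b a≁b

  clique-or-induced-P₃ : Connectedᶜ B → IsClique G B ⊎ ∃ λ x → ∃ λ y → ∃ λ z → InducedP₃ B x y z
  clique-or-induced-P₃ {B} B-connected
    with any? (λ a → any? (λ b → (a ∈? B) ×-dec ((b ∈? B) ×-dec (¬? (a ≟ᶠ b) ×-dec ¬? (a ~? b)))))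
  ... | yes (a , b , a∈B , b∈B , a≢b , a≁b) = inj₂ (non-edge⇒induced-P₃ B-connected a∈B b∈B a≢b a≁b)
  ... | no ¬non-edge = inj₁ clique
    where
    clique : IsClique G B
    clique a b a∈B b∈B a≢b with a ~? b
    ... | yes a~b = a~b
    ... | no  a≁b = contradiction (a , b , a∈B , b∈B , a≢b , a≁b) ¬non-edge

  module NonseparatingP₃ (B : Subset n) (2-connected : ∀ {x} → x ∈ B → Connectedᶜ (B - x))
                         (δ≥3 : ∀ {w} → w ∈ B → 3 ≤ degIn G B w) where

    attach : ∀ {p q Z} → p ∈ B → q ∈ B → p ≢ q → Z ⊆ B - p - q → Nonempty Z → Closed Z (B - p - q) →
             ∃[ y ] y ∈ Z × p ~ y
    attach {p} {q} {Z} p∈B q∈B p≢q Z⊆ Z≢∅ Z-closed with any? (λ y → (y ∈? Z) ×-dec (p ~? y))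
    ... | yes found = found
    ... | no ¬found = contradiction p∈Z (λ p∈Z → proj₁ (proj₂ (x∈p-y-z⁻ B (Z⊆ p∈Z))) refl)
      where
      Z-closed-in-B-q : Closed Z (B - q)
      Z-closed-in-B-q {x} {v} x∈Z v∈ x~v with v ≟ᶠ p
      ... | yes refl = contradiction (x , x∈Z , ~-sym x~v) ¬found
      ... | no  v≢p  = let (v∈B , v≢q) = x∈p-y⁻ B v∈ in Z-closed x∈Z (x∈p-y-z⁺ v∈B v≢p v≢q) x~v
      Z⊆B-q : Z ⊆ B - q
      Z⊆B-q z∈ = let (z∈B , _ , z≢q) = x∈p-y-z⁻ B (Z⊆ z∈) in x∈p∧x≢y⇒x∈p-y z∈B z≢q
      p∈Z : p ∈ Z
      p∈Z = 2-connected q∈B Z⊆B-q Z≢∅ Z-closed-in-B-q (x∈p∧x≢y⇒x∈p-y p∈B p≢q)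

    -- {p , q} separates B: C is a union of some but not all components of B - p - q.
    Separation : Fin n × Fin n × Subset n → Set
    Separation (p , q , C) =
      p ∈ B × q ∈ B × C ⊆ B - p - q × Nonempty C × Closed C (B - p - q) × ∃[ d ] d ∈ B - p - q × d ∉ C

    size : Fin n × Fin n × Subset n → ℕ
    size (_ , _ , C) = ∣ C ∣

    smaller-separation? : ∀ k → Dec (∃[ s ] Separation s × size s < k)
    smaller-separation? k =
      map′ (λ (p , q , C , h) → (p , q , C) , h) (λ ((p , q , C) , h) → p , q , C , h)
        (any? λ p → any? λ q → anySubset? λ C → separation? p q C ×-dec (∣ C ∣ <? k))
      where
      separation? : ∀ p q C → Dec (Separation (p , q , C))
      separation? p q C =
        (p ∈? B) ×-dec (q ∈? B) ×-dec (C ⊆? (B - p - q)) ×-dec nonempty? C ×-dec closed? C (B - p - q) ×-dec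
        any? (λ d → (d ∈? (B - p - q)) ×-dec ¬? (d ∈? C))

    separation⇒≢ : ∀ {p q C} → Separation (p , q , C) → p ≢ q
    separation⇒≢ {p} {C = C} (p∈B , _ , C⊆ , C≢∅ , C-closed , d , d∈ , d∉C) refl =
      d∉C (2-connected p∈B (p─q⊆p (B - p) ⁅ p ⁆ ∘ C⊆) C≢∅ (λ x∈C v∈ → C-closed x∈C (twice v∈))
                       (p─q⊆p (B - p) ⁅ p ⁆ d∈))
      where
      twice : v ∈ B - p → v ∈ B - p - p
      twice v∈ = x∈p∧x≢y⇒x∈p-y v∈ (proj₂ (x∈p-y⁻ B v∈))

    -- Otherwise Z ∩ X would be a closed part of the connected B - e missing p.
    closed-avoiding⇒Empty-∩ : ∀ {p q e f X Z} → p ∈ B → p ~ e → e ∈ B → f ∉ X → Closed X (B - p - q) →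
      Z ⊆ B - e - f → Closed Z (B - e - f) → p ∈ B - e - f → q ∈ B - e - f → p ∉ Z → q ∉ Z → Empty (Z ∩ X)
    closed-avoiding⇒Empty-∩ {p} {q} {e} {f} {X} {Z}
                            p∈B p~e e∈B f∉X X-closed Z⊆ Z-closed p∈B-e-f q∈B-e-f p∉Z q∉Z Z∩X≢∅ =
      p∉Z (p∩q⊆p Z X (2-connected e∈B Z∩X⊆B-e Z∩X≢∅ Z∩X-closed (x∈p∧x≢y⇒x∈p-y p∈B (~⇒≢ p~e))))
      where
      Z∩X⊆B-e : Z ∩ X ⊆ B - e
      Z∩X⊆B-e v∈ = let (v∈B , v≢e , _) = x∈p-y-z⁻ B (Z⊆ (p∩q⊆p Z X v∈)) in x∈p∧x≢y⇒x∈p-y v∈B v≢e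
      Z∩X-closed : Closed (Z ∩ X) (B - e)
      Z∩X-closed {x} {v} x∈ v∈ x~v with x∈p∩q⁻ Z X x∈ | v ≟ᶠ p | v ≟ᶠ q
      ... | x∈Z , _   | yes refl | _        = contradiction (Z-closed x∈Z p∈B-e-f x~v) p∉Z
      ... | x∈Z , _   | no _     | yes refl = contradiction (Z-closed x∈Z q∈B-e-f x~v) q∉Z
      ... | x∈Z , x∈X | no v≢p   | no v≢q   =
        let (v∈B , v≢e) = x∈p-y⁻ B v∈
            v∈X = X-closed x∈X (x∈p-y-z⁺ v∈B v≢p v≢q) x~v
        in x∈p∩q⁺ (Z-closed x∈Z (x∈p-y-z⁺ v∈B v≢e (λ { refl → f∉X v∈X })) x~v , v∈X)

    module Minimal {p q C y z} (p∈B : p ∈ B) (q∈B : q ∈ B) (C⊆ : C ⊆ B - p - q) (C-closed : Closed C (B - p - q))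
                   (y∈C : y ∈ C) (z∈ : z ∈ (B - p - q) ─ C) (p~y : p ~ y) (p~z : p ~ z)
                   (minimal : ∀ {s} → Separation s → ∣ C ∣ ≤ size s) where

      z∈B-p-q : z ∈ B - p - q
      z∈B-p-q = proj₁ (x∈p─q⁻ (B - p - q) C z∈)

      z∉C : z ∉ C
      z∉C = proj₂ (x∈p─q⁻ (B - p - q) C z∈)

      C⊆B : C ⊆ B
      C⊆B v∈C = proj₁ (x∈p-y-z⁻ B (C⊆ v∈C))

      C-avoids-q : v ∈ C → v ≢ q
      C-avoids-q v∈C = proj₂ (proj₂ (x∈p-y-z⁻ B (C⊆ v∈C)))

      C-avoids-z : v ∈ C → v ≢ z
      C-avoids-z v∈C refl = z∉C v∈C

      C-step : x ∈ C → x ~ v → v ∈ B → v ≢ p → v ≢ q → v ∈ C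
      C-step x∈C x~v v∈B v≢p v≢q = C-closed x∈C (x∈p-y-z⁺ v∈B v≢p v≢q) x~v

      C-in-B-y-z : v ∈ C → v ≢ y → v ∈ B - y - z
      C-in-B-y-z v∈C v≢y = x∈p-y-z⁺ (C⊆B v∈C) v≢y (C-avoids-z v∈C)

      y∈B : y ∈ B
      y∈B = C⊆B y∈C

      z∈B : z ∈ B
      z∈B = proj₁ (x∈p-y-z⁻ B z∈B-p-q)

      induced : InducedP₃ B p y z
      induced = p∈B , y∈B , z∈B , p~y , p~z , C-avoids-z y∈C , λ y~z → z∉C (C-closed y∈C z∈B-p-q y~z)

      p∈B-y-z : p ∈ B - y - z
      p∈B-y-z = x∈p-y-z⁺ p∈B (~⇒≢ p~y) (~⇒≢ p~z)

      q∈B-y-z : q ∈ B - y - z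
      q∈B-y-z = x∈p-y-z⁺ q∈B (≢-sym (C-avoids-q y∈C)) (≢-sym (proj₂ (proj₂ (x∈p-y-z⁻ B z∈B-p-q))))

      meets-p-or-q : Z ⊆ B - y - z → Nonempty Z → Closed Z (B - y - z) → p ∈ Z ⊎ q ∈ Z
      meets-p-or-q {Z} Z⊆ (w , w∈Z) Z-closed with p ∈? Z | q ∈? Z
      ... | yes p∈Z | _       = inj₁ p∈Z
      ... | no _    | yes q∈Z = inj₂ q∈Z
      ... | no p∉Z  | no q∉Z with w ∈? C
      ...   | yes w∈C = ⊥-elim (closed-avoiding⇒Empty-∩ p∈B p~y y∈B z∉C C-closed Z⊆ Z-closed p∈B-y-z q∈B-y-z
                                 p∉Z q∉Z (w , x∈p∩q⁺ (w∈Z , w∈C)))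
      ...   | no  w∉C = ⊥-elim (closed-avoiding⇒Empty-∩ p∈B p~z z∈B (λ y∈ → proj₂ (x∈p─q⁻ (B - p - q) C y∈) y∈C)
                                 (─-closed C-closed) (subst (Z ⊆_) swap Z⊆) (subst (Closed Z) swap Z-closed)
                                 (subst (p ∈_) swap p∈B-y-z) (subst (q ∈_) swap q∈B-y-z) p∉Z q∉Z
                                 (w , x∈p∩q⁺ (w∈Z , x∈p∧x∉q⇒x∈p─q w∈B-p-q w∉C)))
        where
        swap : B - y - z ≡ B - z - y
        swap = p─x─y≡p─y─x B y z
        w∈B-p-q : w ∈ B - p - q
        w∈B-p-q = x∈p-y-z⁺ (proj₁ (x∈p-y-z⁻ B (Z⊆ w∈Z))) (λ { refl → p∉Z w∈Z }) (λ { refl → q∉Z w∈Z })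

      module _ {Z} (Z⊆ : Z ⊆ B - y - z) (Z-closed : Closed Z (B - y - z)) (q∈Z : q ∈ Z) (p∉Z : p ∉ Z) where

        Z-avoids-y : v ∈ Z → v ≢ y
        Z-avoids-y v∈Z = proj₁ (proj₂ (x∈p-y-z⁻ B (Z⊆ v∈Z)))

        p≢q : p ≢ q
        p≢q refl = p∉Z q∈Z

        separation-q-y : Nonempty (Z ∩ C) → Separation (q , y , Z ∩ C)
        separation-q-y Z∩C≢∅ = q∈B , y∈B , Z∩C⊆ , Z∩C≢∅ , Z∩C-closed , p , p∈B-q-y , p∉Z ∘ p∩q⊆p Z C
          where
          Z∩C⊆ : Z ∩ C ⊆ B - q - y
          Z∩C⊆ v∈ = let (v∈Z , v∈C) = x∈p∩q⁻ Z C v∈ in x∈p-y-z⁺ (C⊆B v∈C) (C-avoids-q v∈C) (Z-avoids-y v∈Z)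
          Z∩C-closed : Closed (Z ∩ C) (B - q - y)
          Z∩C-closed {x} {v} x∈ v∈ x~v with v ≟ᶠ p
          ... | yes refl = contradiction (Z-closed (p∩q⊆p Z C x∈) p∈B-y-z x~v) p∉Z
          ... | no  v≢p  =
            let (x∈Z , x∈C) = x∈p∩q⁻ Z C x∈
                (v∈B , v≢q , v≢y) = x∈p-y-z⁻ B v∈
                v∈C = C-step x∈C x~v v∈B v≢p v≢q
            in x∈p∩q⁺ (Z-closed x∈Z (C-in-B-y-z v∈C v≢y) x~v , v∈C)
          p∈B-q-y : p ∈ B - q - y
          p∈B-q-y = x∈p-y-z⁺ p∈B p≢q (~⇒≢ p~y)

        separation-p-y : Empty (Z ∩ C) → Nonempty (C - y) → Separation (p , y , C - y)
        separation-p-y Z∩C≡∅ C-y≢∅ = p∈B , y∈B , C-y⊆ , C-y≢∅ , C-y-closed , q , q∈B-p-y , q∉C-y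
          where
          C-y⊆ : C - y ⊆ B - p - y
          C-y⊆ v∈ = let (v∈C , v≢y) = x∈p-y⁻ C v∈ ; (v∈B , v≢p , _) = x∈p-y-z⁻ B (C⊆ v∈C) in
                    x∈p-y-z⁺ v∈B v≢p v≢y
          C-y-closed : Closed (C - y) (B - p - y)
          C-y-closed {x} {v} x∈ v∈ x~v with x∈p-y⁻ C x∈ | v ≟ᶠ q
          ... | x∈C , x≢y | yes refl =
            ⊥-elim (Z∩C≡∅ (x , x∈p∩q⁺ (Z-closed q∈Z (C-in-B-y-z x∈C x≢y) (~-sym x~v) , x∈C)))
          ... | x∈C , _   | no  v≢q  =
            let (v∈B , v≢p , v≢y) = x∈p-y-z⁻ B v∈ in x∈p∧x≢y⇒x∈p-y (C-step x∈C x~v v∈B v≢p v≢q) v≢y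
          q∈B-p-y : q ∈ B - p - y
          q∈B-p-y = x∈p-y-z⁺ q∈B (≢-sym p≢q) (≢-sym (C-avoids-q y∈C))
          q∉C-y : q ∉ C - y
          q∉C-y q∈ = C-avoids-q (proj₁ (x∈p-y⁻ C q∈)) refl

        degIn-y≤2 : Empty (C - y) → degIn G B y ≤ 2
        degIn-y≤2 C-y≡∅ = ⊆⁅x⁆∪⁅y⁆⇒∣p∣≤2 p-or-q
          where
          p-or-q : v ∈ B ∩ nbhd G y → v ≡ p ⊎ v ≡ q
          p-or-q {v} v∈ with v ≟ᶠ p | v ≟ᶠ q
          ... | yes v≡p | _       = inj₁ v≡p
          ... | no _    | yes v≡q = inj₂ v≡q
          ... | no v≢p  | no v≢q  =
            let (v∈B , v∈N) = x∈p∩q⁻ B _ v∈ ; y~v = ∈-nbhd⁻ v∈N in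
            ⊥-elim (C-y≡∅ (v , x∈p∧x≢y⇒x∈p-y (C-step y∈C y~v v∈B v≢p v≢q) (≢-sym (~⇒≢ y~v))))

        q-without-p-impossible : ⊥
        q-without-p-impossible with nonempty? (Z ∩ C)
        ... | yes Z∩C≢∅ = contradiction (minimal (separation-q-y Z∩C≢∅)) (<⇒≱ Z∩C<C)
          where
          Z∩C<C : ∣ Z ∩ C ∣ < ∣ C ∣
          Z∩C<C = p⊂q⇒∣p∣<∣q∣ (p∩q⊆q Z C , y , y∈C , λ y∈ → Z-avoids-y (p∩q⊆p Z C y∈) refl)
        ... | no Z∩C≡∅ with nonempty? (C - y)
        ...   | yes C-y≢∅ = contradiction (minimal (separation-p-y Z∩C≡∅ C-y≢∅)) (<⇒≱ (x∈p⇒∣p-x∣<∣p∣ y∈C))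
        ...   | no  C-y≡∅ = contradiction (δ≥3 y∈B) (<⇒≱ (s≤s (degIn-y≤2 C-y≡∅)))

      p∈closed : Z ⊆ B - y - z → Nonempty Z → Closed Z (B - y - z) → p ∈ Z
      p∈closed {Z} Z⊆ Z≢∅ Z-closed with p ∈? Z | meets-p-or-q Z⊆ Z≢∅ Z-closed
      ... | yes p∈Z | _        = p∈Z
      ... | no  p∉Z | inj₁ p∈Z = contradiction p∈Z p∉Z
      ... | no  p∉Z | inj₂ q∈Z = ⊥-elim (q-without-p-impossible Z⊆ Z-closed q∈Z p∉Z)

      -- Both a closed part and its complement would have to contain p.
      connected : Connectedᶜ (B - y - z)
      connected {Z} Z⊆ Z≢∅ Z-closed {v} v∈ with v ∈? Z
      ... | yes v∈Z = v∈Z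
      ... | no  v∉Z = contradiction (p∈closed Z⊆ Z≢∅ Z-closed) (proj₂ (x∈p─q⁻ (B - y - z) Z p∈complement))
        where
        p∈complement : p ∈ (B - y - z) ─ Z
        p∈complement = p∈closed (p─q⊆p (B - y - z) Z) (v , x∈p∧x∉q⇒x∈p─q v∈ v∉Z) (─-closed Z-closed)

    nonseparating-P₃ : (∃ λ x → ∃ λ y → ∃ λ z → InducedP₃ B x y z) →
                       ∃ λ x → ∃ λ y → ∃ λ z → InducedP₃ B x y z × Connectedᶜ (B - y - z)
    nonseparating-P₃ (x , y , z , P₃@(_ , y∈B , z∈B , _)) with smaller-separation? (suc n)
    ... | no ¬separation = x , y , z , P₃ , connected
      where
      connected : Connectedᶜ (B - y - z)
      connected {Z} Z⊆ Z≢∅ Z-closed {v} v∈ with v ∈? Z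
      ... | yes v∈Z = v∈Z
      ... | no  v∉Z = contradiction
        ((y , z , Z) , (y∈B , z∈B , (λ {_} → Z⊆) , Z≢∅ , (λ {_} {_} → Z-closed) , v , v∈ , v∉Z) , s≤s (∣p∣≤n Z))
        ¬separation
    ... | yes (_ , separation , _) with ∃-minimal size smaller-separation? separation
    ... | (p , q , C) , sep@(p∈B , q∈B , C⊆ , C≢∅ , C-closed , d , d∈ , d∉C) , minimal
      with attach p∈B q∈B (separation⇒≢ sep) C⊆ C≢∅ C-closed
         | attach p∈B q∈B (separation⇒≢ sep) (p─q⊆p (B - p - q) C) (d , x∈p∧x∉q⇒x∈p─q d∈ d∉C) (─-closed C-closed)
    ... | y′ , y′∈C , p~y′ | z′ , z′∈ , p~z′ = p , y′ , z′ , induced , connected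
      where open Minimal p∈B q∈B C⊆ C-closed y′∈C z′∈ p~y′ p~z′ minimal

  module DegreeTwo (B : Subset n) (B-connected : Connectedᶜ B) (δ≡2 : ∀ {w} → w ∈ B → degIn G B w ≡ 2) where

    two-neighbours : ∀ {p q r} → w ∈ B → p ∈ B → q ∈ B → r ∈ B → w ~ p → w ~ q → w ~ r → p ≢ q →
                     r ≡ p ⊎ r ≡ q
    two-neighbours {w} {p} {q} {r} w∈B p∈B q∈B r∈B w~p w~q w~r p≢q with r ≟ᶠ p | r ≟ᶠ q
    ... | yes r≡p | _       = inj₁ r≡p
    ... | no _    | yes r≡q = inj₂ r≡q
    ... | no r≢p  | no r≢q  = contradiction (δ≡2 w∈B) λ δ≡2 → <⇒≱ (≤-reflexive (cong suc δ≡2))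
      (distinct⇒3≤∣p∣ (∈-∩nbhd⁺ p∈B w~p) (∈-∩nbhd⁺ q∈B w~q) (∈-∩nbhd⁺ r∈B w~r) p≢q (≢-sym r≢p) (≢-sym r≢q))

    private
      Other : Fin n → Fin n → Fin n → Set
      Other w p q = q ∈ B × w ~ q × q ≢ p

      other? : ∀ w p → Dec (∃[ q ] Other w p q)
      other? w p = any? (λ q → (q ∈? B) ×-dec ((w ~? q) ×-dec ¬? (q ≟ᶠ p)))

    next : Fin n → Fin n → Fin n
    next w p with other? w p
    ... | yes (q , _) = q
    ... | no _        = p

    next-spec : ∀ {p} → w ∈ B → Other w p (next w p)
    next-spec {w} {p} w∈B with other? w p
    ... | yes (_ , other) = other
    ... | no ¬other = contradiction (subst (_≤ 1) (δ≡2 w∈B) (≤-trans (p⊆q⇒∣p∣≤∣q∣ ⊆⁅p⁆) (≤-reflexive (∣⁅x⁆∣≡1 p))))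
                                    λ { (s≤s ()) }
      where
      ⊆⁅p⁆ : B ∩ nbhd G w ⊆ ⁅ p ⁆
      ⊆⁅p⁆ {q} q∈ with q ≟ᶠ p
      ... | yes refl = x∈⁅x⁆ p
      ... | no  q≢p  = let (q∈B , q∈N) = x∈p∩q⁻ B _ q∈ in ⊥-elim (¬other (q , q∈B , ∈-nbhd⁻ q∈N , q≢p))

    module Walk {x y} (x∈B : x ∈ B) (y∈B : y ∈ B) (x~y : x ~ y) where

      walk : ℕ → Fin n
      walk zero          = x
      walk (suc zero)    = y
      walk (suc (suc i)) = next (walk (suc i)) (walk i)

      walk-edge : ∀ i → walk i ∈ B × walk (suc i) ∈ B × walk i ~ walk (suc i)
      walk-edge zero    = x∈B , y∈B , x~y
      walk-edge (suc i) = let (_ , w∈B , _) = walk-edge i ; (v∈B , w~v , _) = next-spec w∈B in w∈B , v∈B , w~v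

      walk∈B : ∀ i → walk i ∈ B
      walk∈B i = proj₁ (walk-edge i)

      walk~ : ∀ i → walk i ~ walk (suc i)
      walk~ i = proj₂ (proj₂ (walk-edge i))

      no-backtrack : ∀ i → walk (suc (suc i)) ≢ walk i
      no-backtrack i = proj₂ (proj₂ (next-spec (walk∈B (suc i))))

      walk-neighbours : ∀ i {r} → r ∈ B → walk (suc i) ~ r → r ≡ walk i ⊎ r ≡ walk (suc (suc i))
      walk-neighbours i r∈B w~r = two-neighbours (walk∈B (suc i)) (walk∈B i) (walk∈B (suc (suc i))) r∈B
        (~-sym (walk~ i)) (walk~ (suc i)) w~r (≢-sym (no-backtrack i))

      Repeats : ℕ → Set
      Repeats j = ∃[ i ] i < j × walk i ≡ walk j

      first-repeat : ∃[ J ] Repeats J × (∀ {j} → Repeats j → J ≤ j)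
      first-repeat with pigeonhole (n<1+n n) (walk ∘ toℕ)
      ... | i , j , i<j , walk-i≡walk-j = ∃-minimal (λ j → j) repeat-below? (toℕ i , i<j , walk-i≡walk-j)
        where
        repeat-below? : ∀ k → Dec (∃[ j ] Repeats j × j < k)
        repeat-below? k = map′ (λ (j , j<k , r) → j , r , j<k) (λ (j , r , j<k) → j , j<k , r)
          (anyUpTo? (λ j → anyUpTo? (λ i → walk i ≟ᶠ walk j) j) k)

      module FirstRepeat (J′ : ℕ) {i₀} (i₀<J : i₀ < suc J′) (walk-i₀≡ : walk i₀ ≡ walk (suc J′))
                         (first : ∀ {j} → Repeats j → suc J′ ≤ j) where

        J : ℕ
        J = suc J′

        no-repeat-before : ∀ {i k} → i < k → k < J → walk i ≢ walk k
        no-repeat-before i<k k<J walk-i≡ = <⇒≱ k<J (first (_ , i<k , walk-i≡))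

        distinct : ∀ {i k} → i < J → k < J → walk i ≡ walk k → i ≡ k
        distinct {i} {k} i<J k<J walk-i≡ with <-cmp i k
        ... | tri< i<k _ _ = contradiction walk-i≡ (no-repeat-before i<k k<J)
        ... | tri≈ _ i≡k _ = i≡k
        ... | tri> _ _ k<i = contradiction (sym walk-i≡) (no-repeat-before k<i i<J)

        returns-to-start : ∀ i → i < J → walk i ≡ walk J → i ≡ 0
        returns-to-start zero    _   _        = refl
        returns-to-start (suc i) i<J walk-i≡ with walk-neighbours i (walk∈B J′)
                                                  (subst (_~ walk J′) (sym walk-i≡) (~-sym (walk~ J′)))
        ... | inj₁ walk-J′≡ = contradiction (sym walk-J′≡) (no-repeat-before (≤-pred i<J) (n<1+n J′))
        ... | inj₂ walk-J′≡ with <-cmp (suc (suc i)) J′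
        ...   | tri< 2+i<J′ _ _ = contradiction (sym walk-J′≡) (no-repeat-before 2+i<J′ (n<1+n J′))
        ...   | tri≈ _ refl _   = contradiction (sym walk-i≡) (no-backtrack (suc i))
        ...   | tri> _ _ J′<2+i with ≤-antisym (≤-pred J′<2+i) (≤-pred i<J)
        ...     | refl = contradiction (subst (walk J′ ~_) (sym walk-i≡) (walk~ J′)) ~-irrefl

        start≡J : walk 0 ≡ walk J
        start≡J = subst (λ i → walk i ≡ walk J) (returns-to-start _ i₀<J walk-i₀≡) walk-i₀≡

        3≤J : 3 ≤ J
        3≤J = closing-length J′ start≡J
          where
          closing-length : ∀ k → walk 0 ≡ walk (suc k) → 3 ≤ suc k
          closing-length zero          x≡y = contradiction x≡y (~⇒≢ x~y)
          closing-length (suc zero)    x≡  = contradiction (sym x≡) (no-backtrack 0)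
          closing-length (suc (suc k)) _   = s≤s (s≤s (s≤s z≤n))

        0<J : 0 < J
        0<J = s≤s z≤n

        1<J : 1 < J
        1<J = ≤-trans (s≤s (s≤s z≤n)) 3≤J

        succ : ℕ → ℕ
        succ i with suc i <? J
        ... | yes _ = suc i
        ... | no  _ = 0

        succ-< : ∀ {i} → suc i < J → succ i ≡ suc i
        succ-< {i} 1+i<J with suc i <? J
        ... | yes _     = refl
        ... | no  1+i≮J = contradiction 1+i<J 1+i≮J

        succ-last : succ J′ ≡ 0
        succ-last with suc J′ <? J
        ... | yes J<J = contradiction J<J (<-irrefl refl)
        ... | no  _   = refl

        succ-cases : ∀ {i} → i < J → (suc i < J × succ i ≡ suc i) ⊎ (suc i ≡ J × succ i ≡ 0)
        succ-cases {i} i<J with suc i <? J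
        ... | yes 1+i<J = inj₁ (1+i<J , refl)
        ... | no  1+i≮J = inj₂ (≤-antisym i<J (≮⇒≥ 1+i≮J) , refl)

        walk~succ : ∀ {i} → i < J → walk i ~ walk (succ i)
        walk~succ {i} i<J with succ-cases i<J
        ... | inj₁ (_ , succ≡)    = subst (λ k → walk i ~ walk k) (sym succ≡) (walk~ i)
        ... | inj₂ (1+i≡J , succ≡) =
          subst (λ k → walk i ~ walk k) (sym succ≡) (subst (walk i ~_) (trans (cong walk 1+i≡J) (sym start≡J)) (walk~ i))

        cycle-neighbour : ∀ {i r} → i < J → r ∈ B → walk i ~ r → ∃[ k ] k < J × r ≡ walk k × (k ≡ succ i ⊎ i ≡ succ k)
        cycle-neighbour {suc i} i<J r∈B walk-i~r with walk-neighbours i r∈B walk-i~r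
        ... | inj₁ r≡ = i , <-trans (n<1+n i) i<J , r≡ , inj₂ (sym (succ-< i<J))
        ... | inj₂ r≡ with succ-cases i<J
        ...   | inj₁ (2+i<J , succ≡) = suc (suc i) , 2+i<J , r≡ , inj₁ (sym succ≡)
        ...   | inj₂ (2+i≡J , succ≡) = 0 , 0<J , trans r≡ (trans (cong walk 2+i≡J) (sym start≡J)) , inj₁ (sym succ≡)
        cycle-neighbour {zero} {r} _ r∈B x~r with walk-neighbours J′ r∈B (subst (_~ r) start≡J x~r)
        ... | inj₁ r≡ = J′ , n<1+n J′ , r≡ , inj₂ (sym succ-last)
        ... | inj₂ r≡ with walk-neighbours J′ y∈B (subst (_~ y) start≡J x~y)
        ... | inj₁ y≡ = contradiction (sym (distinct 1<J (n<1+n J′) y≡)) λ { refl → <-irrefl refl 3≤J }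
        ...   | inj₂ y≡ = 1 , 1<J , trans r≡ (sym y≡) , inj₁ (sym (succ-< (≤-trans (s≤s (s≤s z≤n)) 3≤J)))

        visited? : ∀ v → Dec (∃[ k ] k < J × walk k ≡ v)
        visited? v = anyUpTo? (λ k → walk k ≟ᶠ v) J

        covers : v ∈ B → ∃[ k ] k < J × walk k ≡ v
        covers v∈B = ∈-select⁻ visited? (B-connected visited⊆B (x , x-visited) visited-closed v∈B)
          where
          visited⊆B : select visited? ⊆ B
          visited⊆B v∈ = let (k , _ , walk-k≡) = ∈-select⁻ visited? v∈ in subst (_∈ B) walk-k≡ (walk∈B k)
          x-visited : x ∈ select visited?
          x-visited = ∈-select⁺ visited? (0 , 0<J , refl)
          visited-closed : Closed (select visited?) B
          visited-closed {v} {r} v∈ r∈B v~r =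
            let (k , k<J , walk-k≡) = ∈-select⁻ visited? v∈
                (k′ , k′<J , r≡ , _) = cycle-neighbour k<J r∈B (subst (_~ r) (sym walk-k≡) v~r)
            in ∈-select⁺ visited? (k′ , k′<J , sym r≡)

        position : Fin n → ℕ
        position v with visited? v
        ... | yes (k , _) = k
        ... | no  _       = 0

        position-spec : v ∈ B → position v < J × walk (position v) ≡ v
        position-spec {v} v∈B with visited? v
        ... | yes (_ , k<J , walk-k≡) = k<J , walk-k≡
        ... | no  ¬visited            = ⊥-elim (¬visited (covers v∈B))

        adjacent-positions : ∀ {i k} → i < J → k < J → walk i ~ walk k → k ≡ succ i ⊎ i ≡ succ k
        adjacent-positions {i} {k} i<J k<J walk-i~ with cycle-neighbour i<J (walk∈B k) walk-i~
        ... | k′ , k′<J , walk-k≡ , adjacent with distinct k<J k′<J walk-k≡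
        ...   | refl = adjacent

        two-colouring : parity J ≡ 0ℙ → ∀ {L a₁ a₂} → a₁ ≢ a₂ → (∀ {v} → v ∈ B → a₁ ∈ₗ L v × a₂ ∈ₗ L v) →
                        Colouring B L
        two-colouring even {L} {a₁} {a₂} a₁≢a₂ a₁a₂∈L =
          record { colour = pick ∘ parity ∘ position ; in-list = pick-in-list ; proper = pick-proper }
          where
          pick : Parity → ℕ
          pick 0ℙ = a₁
          pick 1ℙ = a₂

          pick-injective : ∀ {p q} → pick p ≡ pick q → p ≡ q
          pick-injective {0ℙ} {0ℙ} _  = refl
          pick-injective {0ℙ} {1ℙ} eq = contradiction eq a₁≢a₂
          pick-injective {1ℙ} {0ℙ} eq = contradiction (sym eq) a₁≢a₂
          pick-injective {1ℙ} {1ℙ} _  = refl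

          parity-succ≢ : ∀ {i} → i < J → parity (succ i) ≢ parity i
          parity-succ≢ {i} i<J with succ-cases i<J
          ... | inj₁ (_ , succ≡) = subst (λ k → parity k ≢ parity i) (sym succ≡) (parity-suc≢ i)
          ... | inj₂ (1+i≡J , succ≡) =
            subst (λ k → parity k ≢ parity i) (sym succ≡) (subst (_≢ parity i) (trans (cong parity 1+i≡J) even) (parity-suc≢ i))

          pick-in-list : v ∈ B → pick (parity (position v)) ∈ₗ L v
          pick-in-list {v} v∈B with parity (position v)
          ... | 0ℙ = proj₁ (a₁a₂∈L v∈B)
          ... | 1ℙ = proj₂ (a₁a₂∈L v∈B)

          pick-proper : u ∈ B → v ∈ B → u ~ v → pick (parity (position u)) ≢ pick (parity (position v))
          pick-proper {u} {v} u∈B v∈B u~v same with position-spec u∈B | position-spec v∈B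
          ... | i<J , walk-i≡u | k<J , walk-k≡v
            with adjacent-positions i<J k<J (subst₂ _~_ (sym walk-i≡u) (sym walk-k≡v) u~v)
          ... | inj₁ k≡succ = parity-succ≢ i<J (trans (cong parity (sym k≡succ)) (sym (pick-injective same)))
          ... | inj₂ i≡succ = parity-succ≢ k<J (trans (cong parity (sym i≡succ)) (pick-injective same))

        odd-cycle : ∀ m → J ≡ 3 + 2 * m → IsOddCycle G B
        odd-cycle m J≡ = m , walk ∘ toℕ , injective , (walk∈B ∘ toℕ) , surjective , λ i j → mk⇔ (to i j) (from i j)
          where
          N : ℕ
          N = 3 + 2 * m
          <J : ∀ (k : Fin N) → toℕ k < J
          <J k = subst (toℕ k <_) (sym J≡) (toℕ<n k)
          injective : ∀ {i j} → walk (toℕ i) ≡ walk (toℕ j) → i ≡ j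
          injective {i} {j} eq = toℕ-injective (distinct (<J i) (<J j) eq)
          surjective : ∀ v → v ∈ B → ∃[ i ] walk (toℕ i) ≡ v
          surjective v v∈B with covers v∈B
          ... | k , k<J , walk-k≡ = fromℕ< k<N , trans (cong walk (toℕ-fromℕ< k<N)) walk-k≡
            where
            k<N : k < N
            k<N = subst (k <_) J≡ k<J
          succ≡% : ∀ {i} → i < J → suc i % N ≡ succ i
          succ≡% {i} i<J with succ-cases i<J
          ... | inj₁ (1+i<J , succ≡) = trans (m<n⇒m%n≡m (subst (suc i <_) J≡ 1+i<J)) (sym succ≡)
          ... | inj₂ (1+i≡J , succ≡) = trans (cong (_% N) (trans 1+i≡J J≡)) (trans (n%n≡0 N) (sym succ≡))
          to : ∀ i j → walk (toℕ i) ~ walk (toℕ j) → (suc (toℕ i) % N ≡ toℕ j) ⊎ (suc (toℕ j) % N ≡ toℕ i)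
          to i j walk-i~ with adjacent-positions (<J i) (<J j) walk-i~
          ... | inj₁ j≡succ = inj₁ (trans (succ≡% (<J i)) (sym j≡succ))
          ... | inj₂ i≡succ = inj₂ (trans (succ≡% (<J j)) (sym i≡succ))
          from : ∀ i j → (suc (toℕ i) % N ≡ toℕ j) ⊎ (suc (toℕ j) % N ≡ toℕ i) → walk (toℕ i) ~ walk (toℕ j)
          from i j (inj₁ i→j) = subst (λ k → walk (toℕ i) ~ walk k) (trans (sym (succ≡% (<J i))) i→j) (walk~succ (<J i))
          from i j (inj₂ j→i) =
            ~-sym (subst (λ k → walk (toℕ j) ~ walk k) (trans (sym (succ≡% (<J j))) j→i) (walk~succ (<J j)))

    uncolourable⇒odd-cycle : ∀ {x y L a₁ a₂} → x ∈ B → y ∈ B → x ~ y → a₁ ≢ a₂ →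
                             (∀ {v} → v ∈ B → a₁ ∈ₗ L v × a₂ ∈ₗ L v) → ¬ Colouring B L → IsOddCycle G B
    uncolourable⇒odd-cycle x∈B y∈B x~y a₁≢a₂ a₁a₂∈L ¬colouring with Walk.first-repeat x∈B y∈B x~y
    ... | zero   , (_ , () , _) , _
    ... | suc J′ , (_ , i₀<J , walk-i₀≡) , first with parity (suc J′) in parity≡
    ...   | 0ℙ = ⊥-elim (¬colouring (two-colouring parity≡ a₁≢a₂ a₁a₂∈L))
      where open Walk.FirstRepeat x∈B y∈B x~y J′ i₀<J walk-i₀≡ first
    ...   | 1ℙ = let (m , J≡) = odd⇒≡3+2* (suc J′) parity≡ 3≤J in odd-cycle m J≡
      where open Walk.FirstRepeat x∈B y∈B x~y J′ i₀<J walk-i₀≡ first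

  module Block (B : Subset n) (B-connected : Connectedᶜ B) (2-connected : ∀ {x} → x ∈ B → Connectedᶜ (B - x))
               {L} (U : UniqueLists L) (bounded : DegreeBounded B L) (uncolourable : ¬ Colouring B L) where

    tight : Tight B L
    tight = uncolourable⇒tight U B-connected bounded uncolourable

    -- Tightness makes the residual lists on B ─ K degree-bounded, so greedy colouring
    -- would finish any precolouring of K if every component of B ─ K had slack.
    no-slack-after-precolouring : K ⊆ B → (c : Colouring K L) → ¬ SlackInEveryComponent (B ─ K) (residual L (colour c) K)
    no-slack-after-precolouring {K} K⊆B c slack =
      uncolourable (restrict (p⊆p─q∪q B K) (colouring-∪-residual c (greedy-colouring (residual-unique U (colour c) K) bounded′ slack)))
      where
      bounded′ : DegreeBounded (B ─ K) (residual L (colour c) K)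
      bounded′ w∈ = ≤-length-residual {X = B ─ K} {K = K} U (colour c) (trans (tight (p─q⊆p B K w∈)) (degIn-split K⊆B))

    -- Otherwise precolour x with c ∉ L y: then y has slack in the connected B - x.
    ~⇒list-⊆ : ∀ {x y c} → x ∈ B → y ∈ B → x ~ y → c ∈ₗ L x → c ∈ₗ L y
    ~⇒list-⊆ {x} {y} {c} x∈B y∈B x~y c∈Lx with c ∈ₗ? L y
    ... | yes c∈Ly = c∈Ly
    ... | no  c∉Ly = ⊥-elim (no-slack-after-precolouring ⁅x⁆⊆B x↦c
                              (connected⇒slack {L = residual L (const c) ⁅ x ⁆} (2-connected x∈B) y∈B-x y-slack))
      where
      ⁅x⁆⊆B : ⁅ x ⁆ ⊆ B
      ⁅x⁆⊆B v∈ = subst (_∈ B) (sym (x∈⁅y⁆⇒x≡y x v∈)) x∈B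
      x↦c : Colouring ⁅ x ⁆ L
      x↦c = colouring-const (λ v∈ → subst (λ v → c ∈ₗ L v) (sym (x∈⁅y⁆⇒x≡y x v∈)) c∈Lx)
                            (λ u∈ v∈ → subst₂ (λ u v → ¬ u ~ v) (sym (x∈⁅y⁆⇒x≡y x u∈)) (sym (x∈⁅y⁆⇒x≡y x v∈)) ~-irrefl)
      y∈B-x : y ∈ B - x
      y∈B-x = x∈p∧x≢y⇒x∈p-y y∈B (≢-sym (~⇒≢ x~y))
      y-slack : degIn G (B - x) y < length (residual L (const c) ⁅ x ⁆ y)
      y-slack = begin-strict
        degIn G (B - x) y                             <⟨ degIn-< (p─q⊆p B ⁅ x ⁆) x∈B (λ x∈ → proj₂ (x∈p-y⁻ B x∈) refl) (~-sym x~y) ⟩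
        degIn G B y                                   ≡⟨ tight y∈B ⟨
        length (L y)                                  ≤⟨ length≤length-∖+length (U y) nothing-removed ⟩
        length (residual L (const c) ⁅ x ⁆ y) + 0     ≡⟨ +-identityʳ _ ⟩
        length (residual L (const c) ⁅ x ⁆ y)         ∎
        where
        open ≤-Reasoning
        nothing-removed : ∀ {c′} → c′ ∈ₗ L y → c′ ∈ₗ usedColours (const c) ⁅ x ⁆ y → c′ ∈ₗ []
        nothing-removed c′∈Ly c′∈used =
          contradiction (subst (_∈ₗ L y) (∈-usedColours-const⁻ {K = ⁅ x ⁆} {w = y} c′∈used) c′∈Ly) c∉Ly

    lists-equal : ∀ {x y c} → x ∈ B → y ∈ B → c ∈ₗ L x → c ∈ₗ L y
    lists-equal {x} {y} x∈B y∈B c∈Lx = All.lookup (proj₂ (∈-select⁻ above? (B-connected ⊆B x∈ closed y∈B))) c∈Lx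
      where
      above? : Decidable (λ v → v ∈ B × All.All (_∈ₗ L v) (L x))
      above? v = (v ∈? B) ×-dec All.all? (_∈ₗ? L v) (L x)
      ⊆B : select above? ⊆ B
      ⊆B = proj₁ ∘ ∈-select⁻ above?
      x∈ : Nonempty (select above?)
      x∈ = x , ∈-select⁺ above? (x∈B , All.tabulate (λ c∈ → c∈))
      closed : Closed (select above?) B
      closed u∈ v∈B u~v = let (u∈B , Lx⊆Lu) = ∈-select⁻ above? u∈ in
        ∈-select⁺ above? (v∈B , All.map (~⇒list-⊆ u∈B v∈B u~v) Lx⊆Lu)

    regular : ∀ {x y} → x ∈ B → y ∈ B → degIn G B x ≡ degIn G B y
    regular {x} {y} x∈B y∈B = begin
      degIn G B x   ≡⟨ tight x∈B ⟨
      length (L x)  ≡⟨ ≤-antisym (unique-⊆⇒length≤ (U x) (lists-equal x∈B y∈B))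
                                 (unique-⊆⇒length≤ (U y) (lists-equal y∈B x∈B)) ⟩
      length (L y)  ≡⟨ tight y∈B ⟩
      degIn G B y   ∎
      where open ≡-Reasoning

    δ≥3-impossible : (∀ {w} → w ∈ B → 3 ≤ degIn G B w) → ¬ (∃ λ x → ∃ λ y → ∃ λ z → InducedP₃ B x y z)
    δ≥3-impossible δ≥3 P₃ with NonseparatingP₃.nonseparating-P₃ B 2-connected δ≥3 P₃
    ... | x , y , z , (x∈B , y∈B , z∈B , x~y , x~z , y≢z , y≁z) , B-y-z-connected
      with ∃-∈-of-length (subst (0 <_) (sym (tight y∈B)) (≤-trans (s≤s z≤n) (δ≥3 y∈B)))
    ... | a , a∈Ly = no-slack-after-precolouring yz⊆B yz↦a
                       (connected⇒slack {L = residual L (const a) yz} B─yz-connected x∈B─yz x-slack)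
      where
      yz : Subset n
      yz = ⁅ y ⁆ ∪ ⁅ z ⁆
      y∈yz : y ∈ yz
      y∈yz = x∈p∪q⁺ (inj₁ (x∈⁅x⁆ y))
      z∈yz : z ∈ yz
      z∈yz = x∈p∪q⁺ (inj₂ (x∈⁅x⁆ z))
      yz-cases : v ∈ yz → v ≡ y ⊎ v ≡ z
      yz-cases = x∈⁅y⁆∪⁅z⁆⁻ y z
      yz⊆B : yz ⊆ B
      yz⊆B v∈ = [ (λ { refl → y∈B }) , (λ { refl → z∈B }) ] (yz-cases v∈)
      yz↦a : Colouring yz L
      yz↦a = colouring-const (λ v∈ → lists-equal y∈B (yz⊆B v∈) a∈Ly) independent
        where
        independent : u ∈ yz → v ∈ yz → ¬ u ~ v
        independent u∈ v∈ with yz-cases u∈ | yz-cases v∈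
        ... | inj₁ refl | inj₁ refl = ~-irrefl
        ... | inj₁ refl | inj₂ refl = y≁z
        ... | inj₂ refl | inj₁ refl = y≁z ∘ ~-sym
        ... | inj₂ refl | inj₂ refl = ~-irrefl
      B─yz-connected : Connectedᶜ (B ─ yz)
      B─yz-connected = subst Connectedᶜ (p─q─r≡p─q∪r B ⁅ y ⁆ ⁅ z ⁆) B-y-z-connected
      x∈B─yz : x ∈ B ─ yz
      x∈B─yz = x∈p∧x∉q⇒x∈p─q x∈B (λ x∈yz → [ ~⇒≢ x~y , ~⇒≢ x~z ] (yz-cases x∈yz))
      -- x loses two neighbours but at most one colour.
      x-slack : degIn G (B ─ yz) x < length (residual L (const a) yz x)
      x-slack = +-cancelʳ-≤ 1 (suc (degIn G (B ─ yz) x)) (length (residual L (const a) yz x)) (begin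
        suc (degIn G (B ─ yz) x) + 1              ≡⟨ +-suc (degIn G (B ─ yz) x) 1 ⟨
        degIn G (B ─ yz) x + 2                    ≤⟨ +-monoʳ-≤ (degIn G (B ─ yz) x) (distinct⇒2≤∣p∣ (∈-∩nbhd⁺ y∈yz x~y) (∈-∩nbhd⁺ z∈yz x~z) y≢z) ⟩
        degIn G (B ─ yz) x + degIn G yz x          ≡⟨ trans (tight x∈B) (degIn-split yz⊆B) ⟨
        length (L x)                             ≤⟨ length≤length-∖+length {zs = a ∷ []} (U x) (λ _ c∈used → here (∈-usedColours-const⁻ {K = yz} {w = x} c∈used)) ⟩
        length (residual L (const a) yz x) + 1    ∎)
        where open ≤-Reasoning

    clique-or-odd-cycle : IsClique G B ⊎ IsOddCycle G B
    clique-or-odd-cycle with clique-or-induced-P₃ B-connected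
    ... | inj₁ clique = inj₁ clique
    ... | inj₂ P₃@(x , y , z , x∈B , y∈B , z∈B , x~y , x~z , y≢z , _) with degIn G B x ≟ℕ 2
    ...   | no δx≢2 = ⊥-elim (δ≥3-impossible δ≥3 P₃)
      where
      δ≥3 : ∀ {w} → w ∈ B → 3 ≤ degIn G B w
      δ≥3 w∈B = subst (3 ≤_) (regular x∈B w∈B)
        (≤∧≢⇒< (distinct⇒2≤∣p∣ (∈-∩nbhd⁺ y∈B x~y) (∈-∩nbhd⁺ z∈B x~z) y≢z) (≢-sym δx≢2))
    ...   | yes δx≡2 with length≡2⇒ (trans (tight x∈B) δx≡2)
    ...     | a₁ , a₂ , Lx≡ =
      inj₂ (DegreeTwo.uncolourable⇒odd-cycle B B-connected δ≡2 x∈B y∈B x~y a₁≢a₂ a₁a₂∈L uncolourable)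
      where
      δ≡2 : ∀ {w} → w ∈ B → degIn G B w ≡ 2
      δ≡2 w∈B = trans (sym (regular x∈B w∈B)) δx≡2
      a₁≢a₂ : a₁ ≢ a₂
      a₁≢a₂ a₁≡a₂ = Unique.Unique[x∷xs]⇒x∉xs (subst Unique Lx≡ (U x)) (here a₁≡a₂)
      a₁a₂∈L : ∀ {v} → v ∈ B → a₁ ∈ₗ L v × a₂ ∈ₗ L v
      a₁a₂∈L v∈B = lists-equal x∈B v∈B (subst (a₁ ∈ₗ_) (sym Lx≡) (here refl))
                 , lists-equal x∈B v∈B (subst (a₂ ∈ₗ_) (sym Lx≡) (there (here refl)))

  critical-subset : ¬ Colouring X L → ∃[ S ] S ⊆ X × ¬ Colouring S L × (∀ {x} → x ∈ S → Colouring (S - x) L)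
  critical-subset {X} {L} uncolourable
    with ∃-minimal ∣_∣ (λ k → anySubset? λ S → ((S ⊆? X) ×-dec ¬? (colouring? S L)) ×-dec (∣ S ∣ <? k))
                 ((λ x∈X → x∈X) , uncolourable)
  ... | S , (S⊆X , S-uncolourable) , minimal = S , S⊆X , S-uncolourable , critical
    where
    critical : ∀ {x} → x ∈ S → Colouring (S - x) L
    critical {x} x∈S with colouring? (S - x) L
    ... | yes c  = c
    ... | no ¬c = contradiction (minimal ((S⊆X ∘ p─q⊆p S ⁅ x ⁆) , ¬c)) (<⇒≱ (x∈p⇒∣p-x∣<∣p∣ x∈S))

  module Critical {S L} (U : UniqueLists L) (bounded : DegreeBounded S L) (uncolourable : ¬ Colouring S L)
                  (critical : ∀ {x} → x ∈ S → Colouring (S - x) L) where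

    connected : Connectedᶜ S
    connected {Z} Z⊆S (z , z∈Z) Z-closed {b} b∈S with b ∈? Z
    ... | yes b∈Z = b∈Z
    ... | no  b∉Z = ⊥-elim (uncolourable (restrict (p⊆p─q∪q S Z) (colouring-∪-separated separated Z-colouring rest-colouring)))
      where
      separated : u ∈ Z → v ∈ S ─ Z → ¬ u ~ v
      separated u∈Z v∈ u~v = let (v∈S , v∉Z) = x∈p─q⁻ S Z v∈ in v∉Z (Z-closed u∈Z v∈S u~v)
      Z-colouring : Colouring Z L
      Z-colouring = restrict (λ v∈Z → x∈p∧x≢y⇒x∈p-y (Z⊆S v∈Z) (λ { refl → b∉Z v∈Z })) (critical b∈S)
      rest-colouring : Colouring (S ─ Z) L
      rest-colouring = restrict (λ v∈ → let (v∈S , v∉Z) = x∈p─q⁻ S Z v∈ in x∈p∧x≢y⇒x∈p-y v∈S (λ { refl → v∉Z z∈Z }))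
                                (critical (Z⊆S z∈Z))

    tight : Tight S L
    tight = uncolourable⇒tight U connected bounded uncolourable

    -- Colour everything outside the block B first; every component of S ─ B has a
    -- vertex next to B, which keeps slack.
    block : IsBlock G S B → IsClique G B ⊎ IsOddCycle G B
    block {B} (B⊆S , (b , b∈B) , B-connected , B-2-connected , _) =
      Block.clique-or-odd-cycle B (Connected⇒Connectedᶜ B-connected) (λ x∈B → Connected⇒Connectedᶜ (B-2-connected _ x∈B))
        (residual-unique U (colour outside-colouring) (S ─ B)) residual-bounded residual-uncolourable
      where
      ─B⊆S : S ─ B ⊆ S
      ─B⊆S = p─q⊆p S B
      outside-slack : SlackInEveryComponent (S ─ B) L
      outside-slack {Z} Z⊆ Z≢∅ Z-closed with any? (λ z → any? (λ w → (z ∈? Z) ×-dec ((w ∈? B) ×-dec (z ~? w))))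
      ... | yes (z , w , z∈Z , w∈B , z~w) =
        z , z∈Z , <-≤-trans (degIn-< ─B⊆S (B⊆S w∈B) (λ w∈ → proj₂ (x∈p─q⁻ S B w∈) w∈B) z~w)
                            (≤-reflexive (sym (tight (─B⊆S (Z⊆ z∈Z)))))
      ... | no ¬touches =
        contradiction b∈B (proj₂ (x∈p─q⁻ S B (Z⊆ (connected (─B⊆S ∘ Z⊆) Z≢∅ Z-closed-in-S (B⊆S b∈B)))))
        where
        Z-closed-in-S : Closed Z S
        Z-closed-in-S {x} {w} x∈Z w∈S x~w with w ∈? B
        ... | yes w∈B = contradiction (x , w , x∈Z , w∈B , x~w) ¬touches
        ... | no  w∉B = Z-closed x∈Z (x∈p∧x∉q⇒x∈p─q w∈S w∉B) x~w
      outside-colouring : Colouring (S ─ B) L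
      outside-colouring = greedy-colouring U (λ w∈ → ≤-trans (degIn-mono ─B⊆S) (bounded (─B⊆S w∈))) outside-slack
      residual-bounded : DegreeBounded B (residual L (colour outside-colouring) (S ─ B))
      residual-bounded w∈B = ≤-length-residual {X = B} {K = S ─ B} U (colour outside-colouring)
        (trans (tight (B⊆S w∈B)) (trans (degIn-split B⊆S) (+-comm _ (degIn G B _))))
      residual-uncolourable : ¬ Colouring B (residual L (colour outside-colouring) (S ─ B))
      residual-uncolourable c =
        uncolourable (restrict (subst (S ⊆_) (∪-comm (S ─ B) B) (p⊆p─q∪q S B)) (colouring-∪-residual outside-colouring c))

    gallai-tree : GallaiTree G S
    gallai-tree = nonempty , Connectedᶜ⇒Connected connected , λ _ → block
      where
      nonempty : Nonempty S
      nonempty with nonempty? S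
      ... | yes S≢∅ = S≢∅
      ... | no  S≡∅ = ⊥-elim (uncolourable (colouring-empty S≡∅))

  colouring-or-tight-gallai-tree : UniqueLists L → DegreeBounded X L →
                                   Colouring X L ⊎ ∃[ S ] S ⊆ X × GallaiTree G S × Tight S L
  colouring-or-tight-gallai-tree {L} {X} U bounded with colouring? X L
  ... | yes c = inj₁ c
  ... | no ¬c with critical-subset ¬c
  ...   | S , S⊆X , S-uncolourable , critical = inj₂ (S , S⊆X , gallai-tree , tight)
    where
    open Critical U (λ w∈S → ≤-trans (degIn-mono S⊆X) (bounded (S⊆X w∈S))) S-uncolourable critical

ind-∈ : ∀ {n} (G : Graph n) {U w} → w ∈ U → ind G U w ≡ + 1
ind-∈ G {U} {w} w∈U with lookup U w | []=⇒lookup w∈U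
... | true | _ = refl

ind-∉ : ∀ {n} (G : Graph n) {U w} → w ∉ U → ind G U w ≡ + 0
ind-∉ G {U} {w} w∉U with lookup U w | lookup⇒[]= w U
... | false | _       = refl
... | true  | ∈-of-lookup = contradiction (∈-of-lookup refl) w∉U

module ReducedLists {n} (H : Graph n) (R : Subset n) (dominating : Dominating H R) (f : Fin n → ℕ)
                    (f≥deg : ∀ v → v ∉ R → deg H v ≤ f v) (f>deg : ∀ r → r ∈ R → suc (deg H r) ≤ f r)
                    (no-bad : ∀ (S : Subset n) → GallaiTree H S → ¬ Bad H f S) (u v : Fin n)
                    (¬exception : ¬ (adj H u v ≡ true × ((u ∈ R × v ∉ R) ⊎ (u ∉ R × v ∈ R)))) where

  open ListColouring H

  U₀ : Subset n
  U₀ = ⁅ u ⁆ ∪ ⁅ v ⁆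

  -- D is coloured last: its vertices keep slack whatever happens on X.
  D X : Subset n
  D = R ─ U₀
  X = ⊤ ─ D

  U₀-cases : ∀ {w} → w ∈ U₀ → w ≡ u ⊎ w ≡ v
  U₀-cases = x∈⁅y⁆∪⁅z⁆⁻ u v

  deg≡degIn-D+degIn-X : ∀ w → deg H w ≡ degIn H D w + degIn H X w
  deg≡degIn-D+degIn-X w = begin
    deg H w                           ≡⟨ degIn-⊤ ⟨
    degIn H ⊤ w                       ≡⟨ degIn-split (λ _ → ∈⊤) ⟩
    degIn H X w + degIn H D w         ≡⟨ +-comm (degIn H X w) _ ⟩
    degIn H D w + degIn H X w         ∎
    where open ≡-Reasoning

  dominator-outside-U₀ : ∀ {w r} → w ∈ U₀ → w ∉ R → r ∈ R → w ~ r → r ∉ U₀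
  dominator-outside-U₀ w∈ w∉R r∈R w~r r∈ with U₀-cases w∈ | U₀-cases r∈
  ... | inj₁ refl | inj₁ refl = ~-irrefl w~r
  ... | inj₂ refl | inj₂ refl = ~-irrefl w~r
  ... | inj₁ refl | inj₂ refl = ¬exception (w~r , inj₂ (w∉R , r∈R))
  ... | inj₂ refl | inj₁ refl = ¬exception (~-sym w~r , inj₁ (r∈R , w∉R))

  f-positive : ∀ w → 0 < f w
  f-positive w with w ∈? R
  ... | yes w∈R = ≤-trans (s≤s z≤n) (f>deg w w∈R)
  ... | no  w∉R = let (r , _ , w~r) = dominating w w∉R in ≤-trans (x∈p⇒0<∣p∣ (∈-nbhd⁺ w~r)) (f≥deg w w∉R)

  module _ (L : Fin n → List ℕ) (U : UniqueLists L)
           (length-L : ∀ w → length (L w) ≡ pos H ((+ f w) ℤ.- ind H U₀ w)) where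

    f≡suc-length : ∀ {w} → w ∈ U₀ → f w ≡ suc (length (L w))
    f≡suc-length {w} w∈U₀ =
      from-pos-pred (f w) (f-positive w) (trans (length-L w) (cong (λ i → pos H ((+ f w) ℤ.- i)) (ind-∈ H w∈U₀)))
      where
      from-pos-pred : ∀ a → 0 < a → length (L w) ≡ pos H ((+ a) ℤ.- (+ 1)) → a ≡ suc (length (L w))
      from-pos-pred (suc a) _ eq = cong suc (sym eq)

    f≡length : ∀ {w} → w ∉ U₀ → f w ≡ length (L w)
    f≡length {w} w∉U₀ =
      sym (trans (length-L w) (trans (cong (λ i → pos H ((+ f w) ℤ.- i)) (ind-∉ H w∉U₀)) (+-identityʳ (f w))))

    X-bounded : DegreeBounded X L
    X-bounded {w} w∈X with w ∈? U₀ | w ∈? R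
    ... | no w∉U₀ | yes w∈R = ≤-trans (∣p∩q∣≤∣q∣ X _) (≤-trans (<⇒≤ (f>deg w w∈R)) (≤-reflexive (f≡length w∉U₀)))
    ... | no w∉U₀ | no  w∉R = ≤-trans (∣p∩q∣≤∣q∣ X _) (≤-trans (f≥deg w w∉R) (≤-reflexive (f≡length w∉U₀)))
    ... | yes w∈U₀ | yes w∈R =
      ≤-pred (≤-trans (s≤s (∣p∩q∣≤∣q∣ X _)) (subst (suc (deg H w) ≤_) (f≡suc-length w∈U₀) (f>deg w w∈R)))
    ... | yes w∈U₀ | no  w∉R =
      let (r , r∈R , w~r) = dominating w w∉R
          r∉X = λ r∈X → proj₂ (x∈p─q⁻ ⊤ D r∈X) (x∈p∧x∉q⇒x∈p─q r∈R (dominator-outside-U₀ w∈U₀ w∉R r∈R w~r))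
      in ≤-pred (≤-trans (<-≤-trans (degIn-< (λ _ → ∈⊤) ∈⊤ r∉X w~r) (≤-reflexive degIn-⊤))
                         (subst (deg H w ≤_) (f≡suc-length w∈U₀) (f≥deg w w∉R)))

    bad : ∀ {S} → Tight S L → Bad H f S
    bad {S} tight = S ∩ U₀ , p∩q⊆p S U₀ , ≤-trans (∣p∩q∣≤∣q∣ S U₀) (⊆⁅x⁆∪⁅y⁆⇒∣p∣≤2 U₀-cases) , balance
      where
      balance : ∀ w → w ∈ S → (+ f w) ℤ.- ind H (S ∩ U₀) w ≡ + degIn H S w
      balance w w∈S with w ∈? U₀
      ... | yes w∈U₀ rewrite ind-∈ H (x∈p∩q⁺ (w∈S , w∈U₀)) | f≡suc-length w∈U₀ | tight w∈S = refl
      ... | no  w∉U₀ rewrite ind-∉ H (w∉U₀ ∘ p∩q⊆q S U₀) | f≡length w∉U₀ | tight w∈S = cong +_ (+-identityʳ _)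

    X-colouring : Colouring X L
    X-colouring with colouring-or-tight-gallai-tree U X-bounded
    ... | inj₁ c                        = c
    ... | inj₂ (S , _ , gallai , tight) = ⊥-elim (no-bad S gallai (bad tight))

    D-slack : ∀ {r} → r ∈ D → degIn H D r < length (residual L (colour X-colouring) X r)
    D-slack {r} r∈D = +-cancelʳ-≤ (degIn H X r) _ _ (begin
      suc (degIn H D r) + degIn H X r                        ≡⟨ cong suc (deg≡degIn-D+degIn-X r) ⟨
      suc (deg H r)                                          ≤⟨ f>deg r (proj₁ (x∈p─q⁻ R U₀ r∈D)) ⟩
      f r                                                    ≡⟨ f≡length (proj₂ (x∈p─q⁻ R U₀ r∈D)) ⟩
      length (L r)                                           ≤⟨ length≤length-residual+degIn U (colour X-colouring) X r ⟩
      length (residual L (colour X-colouring) X r) + degIn H X r ∎)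
      where open ≤-Reasoning

    colouring : Colouring ⊤ L
    colouring = restrict (subst (⊤ ⊆_) (∪-comm X D) (p⊆p─q∪q ⊤ D)) (colouring-∪-residual X-colouring D-colouring)
      where
      D-colouring : Colouring D (residual L (colour X-colouring) X)
      D-colouring = greedy-colouring (residual-unique U (colour X-colouring) X) (<⇒≤ ∘ D-slack)
                                     (λ Z⊆D (z , z∈Z) _ → z , z∈Z , D-slack (Z⊆D z∈Z))

  choosable : Choosable H (λ w → (+ f w) ℤ.- ind H U₀ w)
  choosable L U length-L = colour c , (λ _ → in-list c ∈⊤) , (λ _ _ a~b → proper c ∈⊤ ∈⊤ a~b)
    where
    c : Colouring ⊤ L
    c = colouring L U length-L

lemma3p2 : ∀ {n} (H : Graph n) (R : Subset n) → Dominating H R →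
    (f : Fin n → ℕ) →
    (∀ v → v ∉ R → deg H v ≤ f v) → (∀ r → r ∈ R → suc (deg H r) ≤ f r) →
    (∀ (S : Subset n) → GallaiTree H S → ¬ Bad H f S) →
    ∀ u v → Choosable H (λ w → (+ f w) ℤ.- ind H (⁅ u ⁆ ∪ ⁅ v ⁆) w)
            ⊎ (adj H u v ≡ true × ((u ∈ R × v ∉ R) ⊎ (u ∉ R × v ∈ R)))
lemma3p2 H R dominating f f≥deg f>deg no-bad u v
  with (adj H u v ≟ᵇ true) ×-dec (((u ∈? R) ×-dec ¬? (v ∈? R)) ⊎-dec (¬? (u ∈? R) ×-dec (v ∈? R)))
... | yes exception  = inj₂ exception
... | no  ¬exception = inj₁ (ReducedLists.choosable H R dominating f f≥deg f>deg no-bad u v ¬exception)
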